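{- As formal power series, $$\mathcal{L}(x,u)=\mathcal{N}(x,u)\left(\mathcal{S}(x,u)-\frac{x}{1-x}\right).$$
   Context: $\mathbf{N}_n$ is the set of sequences $w=w_1\cdots w_n$ of nonnegative integers; $\mathsf{lar}(w)=\max_i w_i$, $\mathsf{sma}(w)=\min_i w_i$, $\mathsf{R}_{\mathsf{lar}}(w)=\max\{i:w_i=\mathsf{lar}(w)\}$, $\mathsf{R}_{\mathsf{sma}}(w)=\max\{i:w_i=\mathsf{sma}(w)\}$, $\mathsf{asc}(w)=|\{i\in[n-1]:w_i<w_{i+1}\}|$. $\mathbf{SL}_n=\{w\in\mathbf{N}_n:\mathsf{R}_{\mathsf{lar}}(w)\ge\mathsf{R}_{\mathsf{sma}}(w)\}$ and $\mathbf{LS}_n=\{w\in\mathbf{N}_n:\mathsf{R}_{\mathsf{lar}}(w)<\mathsf{R}_{\mathsf{sma}}(w)\}$. For a set $X$ of sequences, $X(021)$ denotes those $w\in X$ with no indices $i<j<k$ such that $w_i<w_k<w_j$. Define $\mathcal{N}(x,u)=\sum_{n\ge1}x^n\sum_{w\in\mathbf{N}_n(021)}u^{\mathsf{lar}(w)}t^{\mathsf{asc}(w)}$, $\mathcal{S}(x,u)=\sum_{n\ge1}x^n\sum_{w\in\mathbf{SL}_n(021)}u^{\mathsf{lar}(w)}t^{\mathsf{asc}(w)}$, $\mathcal{L}(x,u)=\sum_{n\ge1}x^n\sum_{w\in\mathbf{LS}_n(021)}u^{\mathsf{lar}(w)}t^{\mathsf{asc}(w)}$. -}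

module Defs where

open import Data.Nat using (ℕ; zero; suc; _+_; _*_; _∸_; _⊔_; _⊓_; _<ᵇ_; _≡ᵇ_)
open import Data.Bool using (Bool; true; false; _∧_; _∨_; not; if_then_else_)
open import Data.List using (List; []; _∷_; map; concatMap; foldr; upTo; allFin)
open import Data.Bool.ListAction using (any)
open import Data.Vec using (Vec; []; _∷_; lookup)
open import Data.Fin using (Fin; toℕ)
open import Data.Integer as ℤ using (ℤ; +_)

-- A sequence w = w_1 ⋯ w_n of nonnegative integers is a  Vec ℕ n ;
-- position i : Fin n corresponds to the 1-based index  suc (toℕ i).

maxL : List ℕ → ℕ
maxL = foldr _⊔_ 0

values : ∀ {n} → Vec ℕ n → List ℕ
values {n} w = map (lookup w) (allFin n)

lar : ∀ {n} → Vec ℕ n → ℕ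
lar w = maxL (values w)

-- sma(w) = min_i w_i  (only used for n ≥ 1)
sma : ∀ {n} → Vec ℕ n → ℕ
sma [] = 0
sma (x ∷ xs) = foldr _⊓_ x (values xs)

-- largest 1-based index i with w_i = v  (0 if none)
lastIndexOf : ∀ {n} → ℕ → Vec ℕ n → ℕ
lastIndexOf {n} v w =
  maxL (map (λ i → if lookup w i ≡ᵇ v then suc (toℕ i) else 0) (allFin n))

Rlar : ∀ {n} → Vec ℕ n → ℕ
Rlar w = lastIndexOf (lar w) w

Rsma : ∀ {n} → Vec ℕ n → ℕ
Rsma w = lastIndexOf (sma w) w

asc : ∀ {n} → Vec ℕ n → ℕ
asc [] = 0
asc (x ∷ []) = 0
asc (x ∷ y ∷ ys) = (if x <ᵇ y then 1 else 0) + asc (y ∷ ys)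

contains021 : ∀ {n} → Vec ℕ n → Bool
contains021 {n} w =
  any (λ i → any (λ j → any (λ k →
        (toℕ i <ᵇ toℕ j) ∧ (toℕ j <ᵇ toℕ k)
        ∧ (lookup w i <ᵇ lookup w k) ∧ (lookup w k <ᵇ lookup w j))
      (allFin n)) (allFin n)) (allFin n)

isSL : ∀ {n} → Vec ℕ n → Bool
isSL w = Rsma w <ᵇ suc (Rlar w)          -- Rlar w ≥ Rsma w

isLS : ∀ {n} → Vec ℕ n → Bool
isLS w = Rlar w <ᵇ Rsma w

vecsUpTo : (n a : ℕ) → List (Vec ℕ n)
vecsUpTo zero a = [] ∷ []
vecsUpTo (suc n) a = concatMap (λ v → map (λ x → x ∷ v) (upTo (suc a))) (vecsUpTo n a)

count : ∀ {A : Set} → (A → Bool) → List A → ℕ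
count p [] = 0
count p (x ∷ xs) = if p x then suc (count p xs) else count p xs

-- number of w ∈ N_n(021) with the extra property P, lar(w) = a, asc(w) = b.
-- (Any w with lar(w) = a has all entries in {0,…,a}, so the enumeration is complete.)
coeff : (P : ∀ {n} → Vec ℕ n → Bool) → ℕ → ℕ → ℕ → ℕ
coeff P zero a b = 0          -- the series start at n ≥ 1
coeff P (suc n) a b =
  count (λ w → P w ∧ (lar w ≡ᵇ a) ∧ (asc w ≡ᵇ b) ∧ not (contains021 w))
        (vecsUpTo (suc n) a)

coefN coefS coefL : ℕ → ℕ → ℕ → ℕ
coefN = coeff (λ _ → true)
coefS = coeff isSL
coefL = coeff isLS

-- [x^n u^a t^b] x/(1-x)
coefGeom : ℕ → ℕ → ℕ → ℕ
coefGeom zero a b = 0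
coefGeom (suc n) zero zero = 1
coefGeom (suc n) _ _ = 0

Series : Set
Series = ℕ → ℕ → ℕ → ℤ

sumℤ : List ℤ → ℤ
sumℤ = foldr ℤ._+_ (+ 0)

conv1 : ℕ → (ℕ → ℕ → ℤ) → ℤ
conv1 k f = sumℤ (map (λ i → f i (k ∸ i)) (upTo (suc k)))

_⊛_ : Series → Series → Series
(F ⊛ G) n a b =
  conv1 n λ n₁ n₂ → conv1 a λ a₁ a₂ → conv1 b λ b₁ b₂ →
    F n₁ a₁ b₁ ℤ.* G n₂ a₂ b₂

_⊝_ : Series → Series → Series
(F ⊝ G) n a b = F n a b ℤ.- G n a b

ofℕ : (ℕ → ℕ → ℕ → ℕ) → Series
ofℕ f n a b = + f n a b

𝓝 𝓢 𝓛 geom : Series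
𝓝 = ofℕ coefN
𝓢 = ofℕ coefS
𝓛 = ofℕ coefL
geom = ofℕ coefGeom

-- Cut a word w of LS(021) right after the last occurrence of its largest letter M: w = s v.
-- Since w is in LS, v contains the last smallest letter and is nonempty. Every letter of v is
-- smaller than M, so avoiding 021 forces every letter of s to be at least every letter of v;
-- s ends with its maximum, hence lies in SL. Conversely every pair (s, v) of this kind gives a
-- word s v of LS(021) cut exactly there, since the cut is the position of the last maximum.
-- Lowering all letters of s by max v turns s into an arbitrary word s′ of SL(021) with
-- lar(s′) ≥ 1 (such words end with their maximum), and lar(w) = lar(v) + lar(s′),
-- asc(w) = asc(v) + asc(s′). This gives N · (S − S₀), where S₀ = x/(1−x) counts the SL words
-- with lar = 0, the constant words 0⋯0.

module Submission where

open import Data.Bool using (Bool; true; false; _∧_; _∨_; not; if_then_else_)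
open import Data.Bool.ListAction using (any; or)
open import Data.Bool.Properties
  using (∧-zeroʳ; ∧-assoc; ∧-comm; ∧-conicalˡ; ∧-conicalʳ; not-injective; ∨-zeroʳ; ∨-identityʳ; ∨-assoc;
         ∨-conicalˡ; ∨-conicalʳ)
open import Data.Empty using (⊥-elim)
open import Data.Fin using (Fin; toℕ) renaming (zero to fzero; suc to fsuc)
open import Data.Integer as ℤ using (ℤ)
import Data.Integer.Properties as ℤ
open import Data.List
  using (List; []; _∷_; [_]; map; concatMap; upTo; applyUpTo; _++_; length; take; drop; null; foldr; allFin;
         replicate)
open import Data.List.Membership.Propositional using (_∈_; _∉_)
open import Data.List.Membership.Propositional.Properties using (∈-++⁺ʳ; ∈-++⁻)
open import Data.List.Properties
  using (map-tabulate; map-cong; map-∘; length-++; ++-assoc; ++-identityʳ; length-take; take++drop≡id)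
open import Data.List.Relation.Unary.All as All using (All; all?)
open import Data.List.Relation.Unary.All.Properties using () renaming (map⁺ to All-map⁺)
open import Data.List.Relation.Unary.Any using (here; there)
open import Data.Nat
  using (ℕ; zero; suc; _+_; _*_; _∸_; _⊔_; _⊓_; _<ᵇ_; _≤ᵇ_; _≡ᵇ_; _≤_; _<_; z≤n; s≤s; s≤s⁻¹; z<s; s<s)
open import Data.Nat.Properties
open import Algebra.Properties.CommutativeSemigroup +-commutativeSemigroup
  using () renaming (interchange to +-interchange)
open import Data.List.Membership.DecPropositional _≟_ using (_∈?_)
open import Data.Nat.Tactic.RingSolver using (solve-∀)
open import Data.Product using (∃₂; _×_; _,_)
open import Data.Sum using (inj₁; inj₂)
open import Data.Vec using (Vec; []; _∷_; lookup; toList)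
open import Defs
open import Function using (_∘_; id; case_of_)
open import Relation.Binary.PropositionalEquality
  using (_≡_; _≢_; refl; sym; trans; cong; cong₂; subst; module ≡-Reasoning)
open import Relation.Nullary using (Dec; yes; no; does; ¬_)
open import Relation.Nullary.Decidable using (dec-true; dec-false)

-- Indicators and finite sums

𝟙 : Bool → ℕ
𝟙 true = 1
𝟙 false = 0

𝟙-∧ : ∀ p q → 𝟙 (p ∧ q) ≡ 𝟙 p * 𝟙 q
𝟙-∧ true q = sym (+-identityʳ (𝟙 q))
𝟙-∧ false q = refl

does⇒ : ∀ {A : Set} (a? : Dec A) → does a? ≡ true → A
does⇒ (yes a) _ = a

∧-rotate : ∀ p m a c → p ∧ (m ∧ (a ∧ c)) ≡ (p ∧ c) ∧ (m ∧ a)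
∧-rotate false m a c = refl
∧-rotate true m a c = trans (sym (∧-assoc m a c)) (∧-comm (m ∧ a) c)

<ᵇ-suc : ∀ m n → (m <ᵇ suc n) ≡ (m ≤ᵇ n)
<ᵇ-suc zero n = refl
<ᵇ-suc (suc m) n = refl

𝟙-positive-≡ᵇ : ∀ m e → 𝟙 (0 <ᵇ m) * 𝟙 (m ≡ᵇ e) ≡ 𝟙 (0 <ᵇ e) * 𝟙 (m ≡ᵇ e)
𝟙-positive-≡ᵇ m e with m ≟ e
... | yes refl = refl
... | no m≢e rewrite dec-false (m ≟ e) m≢e = trans (*-zeroʳ (𝟙 (0 <ᵇ m))) (sym (*-zeroʳ (𝟙 (0 <ᵇ e))))

𝟙-+-≡ᵇ : ∀ x y b → 𝟙 (x + y ≡ᵇ b) ≡ 𝟙 (y ≤ᵇ b) * 𝟙 (x ≡ᵇ b ∸ y)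
𝟙-+-≡ᵇ x y b with y ≤? b
... | no y≰b rewrite dec-false (y ≤? b) y≰b =
  cong 𝟙 (dec-false (x + y ≟ b) λ x+y≡b → y≰b (subst (y ≤_) x+y≡b (m≤n+m y x)))
... | yes y≤b rewrite dec-true (y ≤? b) y≤b = trans (cong 𝟙 same) (sym (+-identityʳ _))
  where
  same : (x + y ≡ᵇ b) ≡ (x ≡ᵇ b ∸ y)
  same with x ≟ b ∸ y
  ... | yes x≡b∸y rewrite dec-true (x ≟ b ∸ y) x≡b∸y =
    dec-true (x + y ≟ b) (trans (cong (_+ y) x≡b∸y) (m∸n+n≡m y≤b))
  ... | no x≢b∸y rewrite dec-false (x ≟ b ∸ y) x≢b∸y =
    dec-false (x + y ≟ b) λ x+y≡b → x≢b∸y (trans (sym (m+n∸n≡m x y)) (cong (_∸ y) x+y≡b))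

∑ : {A : Set} → List A → (A → ℕ) → ℕ
∑ [] f = 0
∑ (x ∷ xs) f = f x + ∑ xs f

syntax ∑ xs (λ x → e) = ∑[ x ∈ xs ] e

∑< : ℕ → (ℕ → ℕ) → ℕ
∑< zero f = 0
∑< (suc n) f = f 0 + ∑< n (f ∘ suc)

syntax ∑< n (λ i → e) = ∑[ i < n ] e

module _ {A : Set} where

  ∑-cong : ∀ (xs : List A) {f g : A → ℕ} → (∀ x → f x ≡ g x) → ∑ xs f ≡ ∑ xs g
  ∑-cong [] eq = refl
  ∑-cong (x ∷ xs) eq = cong₂ _+_ (eq x) (∑-cong xs eq)

  ∑-zero : ∀ (xs : List A) → ∑[ x ∈ xs ] 0 ≡ 0
  ∑-zero [] = refl
  ∑-zero (x ∷ xs) = ∑-zero xs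

  ∑-+ : ∀ (xs : List A) (f g : A → ℕ) → ∑[ x ∈ xs ] (f x + g x) ≡ ∑ xs f + ∑ xs g
  ∑-+ [] f g = refl
  ∑-+ (x ∷ xs) f g = trans (cong (f x + g x +_) (∑-+ xs f g)) (+-interchange (f x) (g x) _ _)

  ∑-++ : ∀ (xs ys : List A) f → ∑ (xs ++ ys) f ≡ ∑ xs f + ∑ ys f
  ∑-++ [] ys f = refl
  ∑-++ (x ∷ xs) ys f = trans (cong (f x +_) (∑-++ xs ys f)) (sym (+-assoc (f x) _ _))

  ∑-*ˡ : ∀ c (xs : List A) f → c * ∑ xs f ≡ ∑[ x ∈ xs ] (c * f x)
  ∑-*ˡ c [] f = *-zeroʳ c
  ∑-*ˡ c (x ∷ xs) f = trans (*-distribˡ-+ c (f x) _) (cong (c * f x +_) (∑-*ˡ c xs f))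

  ∑-*ʳ : ∀ c (xs : List A) f → ∑ xs f * c ≡ ∑[ x ∈ xs ] (f x * c)
  ∑-*ʳ c xs f = trans (*-comm (∑ xs f) c) (trans (∑-*ˡ c xs f) (∑-cong xs (λ x → *-comm c (f x))))

∑-map : ∀ {A B : Set} (g : A → B) xs f → ∑ (map g xs) f ≡ ∑ xs (f ∘ g)
∑-map g [] f = refl
∑-map g (x ∷ xs) f = cong (f (g x) +_) (∑-map g xs f)

∑-concatMap : ∀ {A B : Set} (g : A → List B) xs f → ∑ (concatMap g xs) f ≡ ∑[ x ∈ xs ] ∑ (g x) f
∑-concatMap g [] f = refl
∑-concatMap g (x ∷ xs) f = trans (∑-++ (g x) _ f) (cong (∑ (g x) f +_) (∑-concatMap g xs f))

∑-comm : ∀ {A B : Set} (xs : List A) (ys : List B) (f : A → B → ℕ) →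
         ∑[ x ∈ xs ] ∑[ y ∈ ys ] f x y ≡ ∑[ y ∈ ys ] ∑[ x ∈ xs ] f x y
∑-comm [] ys f = sym (∑-zero ys)
∑-comm (x ∷ xs) ys f = trans (cong (∑ ys (f x) +_) (∑-comm xs ys f)) (sym (∑-+ ys (f x) _))

∑-applyUpTo : ∀ {A : Set} n (g : ℕ → A) f → ∑ (applyUpTo g n) f ≡ ∑< n (f ∘ g)
∑-applyUpTo zero g f = refl
∑-applyUpTo (suc n) g f = cong (f (g 0) +_) (∑-applyUpTo n (g ∘ suc) f)

∑<-cong : ∀ n {f g : ℕ → ℕ} → (∀ i → i < n → f i ≡ g i) → ∑< n f ≡ ∑< n g
∑<-cong zero eq = refl
∑<-cong (suc n) eq = cong₂ _+_ (eq 0 z<s) (∑<-cong n (λ i i<n → eq (suc i) (s<s i<n)))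

∑<-zero : ∀ n (f : ℕ → ℕ) → (∀ i → i < n → f i ≡ 0) → ∑< n f ≡ 0
∑<-zero n f eq = trans (∑<-cong n eq) (go n)
  where
  go : ∀ n → ∑[ i < n ] 0 ≡ 0
  go zero = refl
  go (suc n) = go n

∑<-+ : ∀ m d (f : ℕ → ℕ) → ∑< (m + d) f ≡ ∑< m f + ∑[ i < d ] f (m + i)
∑<-+ zero d f = refl
∑<-+ (suc m) d f = trans (cong (f 0 +_) (∑<-+ m d (f ∘ suc))) (sym (+-assoc (f 0) _ _))

∑<-collapse : ∀ n x (g : ℕ → ℕ) → ∑[ i < n ] (𝟙 (x ≡ᵇ i) * g i) ≡ 𝟙 (x <ᵇ n) * g x
∑<-collapse zero x g = refl
∑<-collapse (suc n) zero g =
  cong₂ _+_ (+-identityʳ (g 0)) (∑<-zero n _ (λ _ _ → refl))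
∑<-collapse (suc n) (suc x) g = ∑<-collapse n x (g ∘ suc)

∑<-𝟙-unique : ∀ n (p : ℕ → Bool) {x} → x < n → p x ≡ true →
              (∀ {i} → i < n → p i ≡ true → i ≡ x) → ∑[ i < n ] 𝟙 (p i) ≡ 1
∑<-𝟙-unique (suc n) p {zero} _ px unique =
  cong₂ _+_ (cong 𝟙 px) (∑<-zero n _ λ i i<n → cong 𝟙 (others i i<n))
  where
  others : ∀ i → i < n → p (suc i) ≡ false
  others i i<n with p (suc i) in eq
  ... | true = case unique (s<s i<n) eq of λ ()
  ... | false = refl
∑<-𝟙-unique (suc n) p {suc x} (s<s x<n) px unique =
  cong₂ _+_ (cong 𝟙 p0) (∑<-𝟙-unique n (p ∘ suc) x<n px λ i<n → suc-injective ∘ unique (s<s i<n))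
  where
  p0 : p 0 ≡ false
  p0 with p 0 in eq
  ... | true = case unique z<s eq of λ ()
  ... | false = refl

∑<-∑-comm : ∀ {A : Set} n (xs : List A) (f : ℕ → A → ℕ) →
            ∑[ i < n ] ∑ xs (f i) ≡ ∑[ x ∈ xs ] ∑[ i < n ] f i x
∑<-∑-comm n xs f = begin
  ∑[ i < n ] ∑ xs (f i)           ≡⟨ ∑-applyUpTo n id _ ⟨
  ∑[ i ∈ upTo n ] ∑ xs (f i)      ≡⟨ ∑-comm (upTo n) xs f ⟩
  ∑[ x ∈ xs ] ∑[ i ∈ upTo n ] f i x ≡⟨ ∑-cong xs (λ x → ∑-applyUpTo n id _) ⟩
  ∑[ x ∈ xs ] ∑[ i < n ] f i x    ∎
  where open ≡-Reasoning

∑<-*ˡ : ∀ c n (f : ℕ → ℕ) → c * ∑< n f ≡ ∑[ i < n ] (c * f i)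
∑<-*ˡ c zero f = *-zeroʳ c
∑<-*ˡ c (suc n) f = trans (*-distribˡ-+ c (f 0) _) (cong (c * f 0 +_) (∑<-*ˡ c n (f ∘ suc)))

-- Enumerating words with bounded letters

listsUpTo : ℕ → ℕ → List (List ℕ)
listsUpTo zero a = [] ∷ []
listsUpTo (suc n) a = concatMap (λ v → map (λ x → x ∷ v) (upTo (suc a))) (listsUpTo n a)

∑-extend : ∀ {A B : Set} m (cons : ℕ → A → B) (vs : List A) f →
           ∑ (concatMap (λ v → map (λ x → cons x v) (upTo m)) vs) f ≡ ∑[ v ∈ vs ] ∑[ x < m ] f (cons x v)
∑-extend m cons vs f =
  trans (∑-concatMap _ vs f) (∑-cong vs λ v → trans (∑-map _ (upTo m) f) (∑-applyUpTo m id _))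

∑-listsUpTo-suc : ∀ n a f →
                  ∑ (listsUpTo (suc n) a) f ≡ ∑[ v ∈ listsUpTo n a ] ∑[ x < suc a ] f (x ∷ v)
∑-listsUpTo-suc n a = ∑-extend (suc a) _∷_ (listsUpTo n a)

∑-vecsUpTo : ∀ n a (f : List ℕ → ℕ) → ∑[ w ∈ vecsUpTo n a ] f (toList w) ≡ ∑ (listsUpTo n a) f
∑-vecsUpTo zero a f = refl
∑-vecsUpTo (suc n) a f = begin
  ∑[ w ∈ vecsUpTo (suc n) a ] f (toList w)                ≡⟨ ∑-extend (suc a) _∷_ (vecsUpTo n a) _ ⟩
  ∑[ v ∈ vecsUpTo n a ] ∑[ x < suc a ] f (x ∷ toList v)   ≡⟨ ∑-vecsUpTo n a _ ⟩
  ∑[ v ∈ listsUpTo n a ] ∑[ x < suc a ] f (x ∷ v)         ≡⟨ ∑-listsUpTo-suc n a f ⟨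
  ∑ (listsUpTo (suc n) a) f                               ∎
  where open ≡-Reasoning

listsUpTo-cong : ∀ n a {f g : List ℕ → ℕ} → (∀ w → length w ≡ n → maxL w ≤ a → f w ≡ g w) →
                 ∑ (listsUpTo n a) f ≡ ∑ (listsUpTo n a) g
listsUpTo-cong zero a eq = cong (_+ 0) (eq [] refl z≤n)
listsUpTo-cong (suc n) a {f} {g} eq = begin
  ∑ (listsUpTo (suc n) a) f                       ≡⟨ ∑-listsUpTo-suc n a f ⟩
  ∑[ v ∈ listsUpTo n a ] ∑[ x < suc a ] f (x ∷ v) ≡⟨ listsUpTo-cong n a (λ v ∣v∣ v≤a →
                                                       ∑<-cong (suc a) λ x x≤a →
                                                         eq (x ∷ v) (cong suc ∣v∣) (⊔-lub (s≤s⁻¹ x≤a) v≤a)) ⟩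
  ∑[ v ∈ listsUpTo n a ] ∑[ x < suc a ] g (x ∷ v) ≡⟨ ∑-listsUpTo-suc n a g ⟨
  ∑ (listsUpTo (suc n) a) g                       ∎
  where open ≡-Reasoning

∑-listsUpTo-++ : ∀ k j a (f : List ℕ → ℕ) →
                 ∑ (listsUpTo (k + j) a) f ≡ ∑[ s ∈ listsUpTo k a ] ∑[ v ∈ listsUpTo j a ] f (s ++ v)
∑-listsUpTo-++ zero j a f = sym (+-identityʳ _)
∑-listsUpTo-++ (suc k) j a f = begin
  ∑ (listsUpTo (suc k + j) a) f                                          ≡⟨ ∑-listsUpTo-suc (k + j) a f ⟩
  ∑[ w ∈ listsUpTo (k + j) a ] ∑[ x < suc a ] f (x ∷ w)                  ≡⟨ ∑-listsUpTo-++ k j a _ ⟩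
  ∑[ s ∈ listsUpTo k a ] ∑[ v ∈ listsUpTo j a ] ∑[ x < suc a ] f (x ∷ s ++ v)
    ≡⟨ ∑-cong (listsUpTo k a) (λ s → ∑<-∑-comm (suc a) (listsUpTo j a) (λ x v → f (x ∷ s ++ v))) ⟨
  ∑[ s ∈ listsUpTo k a ] ∑[ x < suc a ] ∑[ v ∈ listsUpTo j a ] f (x ∷ s ++ v)
    ≡⟨ ∑-listsUpTo-suc k a _ ⟨
  ∑[ s ∈ listsUpTo (suc k) a ] ∑[ v ∈ listsUpTo j a ] f (s ++ v)         ∎
  where open ≡-Reasoning

∑-listsUpTo-raise : ∀ j a d (F : List ℕ → ℕ) → (∀ v → a < maxL v → F v ≡ 0) →
                    ∑ (listsUpTo j (a + d)) F ≡ ∑ (listsUpTo j a) F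
∑-listsUpTo-raise zero a d F vanish = refl
∑-listsUpTo-raise (suc j) a d F vanish = begin
  ∑ (listsUpTo (suc j) (a + d)) F                       ≡⟨ ∑-listsUpTo-suc j (a + d) F ⟩
  ∑[ v ∈ listsUpTo j (a + d) ] ∑[ x < suc a + d ] F (x ∷ v)
    ≡⟨ ∑-cong (listsUpTo j (a + d)) (λ v → trans (∑<-+ (suc a) d (λ x → F (x ∷ v))) (drop-high v)) ⟩
  ∑[ v ∈ listsUpTo j (a + d) ] ∑[ x < suc a ] F (x ∷ v)
    ≡⟨ ∑-listsUpTo-raise j a d _ (λ v a<v → ∑<-zero (suc a) _ λ x _ →
         vanish (x ∷ v) (<-≤-trans a<v (m≤n⊔m x (maxL v)))) ⟩
  ∑[ v ∈ listsUpTo j a ] ∑[ x < suc a ] F (x ∷ v)       ≡⟨ ∑-listsUpTo-suc j a F ⟨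
  ∑ (listsUpTo (suc j) a) F                             ∎
  where
  open ≡-Reasoning
  drop-high : ∀ v → ∑< (suc a) (λ x → F (x ∷ v)) + ∑[ i < d ] F (suc a + i ∷ v) ≡ ∑< (suc a) (λ x → F (x ∷ v))
  drop-high v = trans (cong (∑< (suc a) (λ x → F (x ∷ v)) +_) (∑<-zero d _ λ i _ →
                  vanish (suc a + i ∷ v) (<-≤-trans (s≤s (m≤m+n a i)) (m≤m⊔n _ (maxL v)))))
                (+-identityʳ _)

∑-listsUpTo-shift : ∀ k c e (F : List ℕ → ℕ) → (∀ s → ¬ All (c ≤_) s → F s ≡ 0) →
                    ∑ (listsUpTo k (c + e)) F ≡ ∑[ s ∈ listsUpTo k e ] F (map (c +_) s)
∑-listsUpTo-shift zero c e F vanish = refl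
∑-listsUpTo-shift (suc k) c e F vanish = begin
  ∑ (listsUpTo (suc k) (c + e)) F                             ≡⟨ ∑-listsUpTo-suc k (c + e) F ⟩
  ∑[ v ∈ listsUpTo k (c + e) ] ∑[ x < suc (c + e) ] F (x ∷ v)
    ≡⟨ ∑-cong (listsUpTo k (c + e)) (λ v → trans (cong (λ m → ∑< m (λ x → F (x ∷ v))) (sym (+-suc c e)))
                                          (trans (∑<-+ c (suc e) (λ x → F (x ∷ v))) (drop-low v))) ⟩
  ∑[ v ∈ listsUpTo k (c + e) ] ∑[ y < suc e ] F (c + y ∷ v)
    ≡⟨ ∑-listsUpTo-shift k c e _ (λ v v≱c → ∑<-zero (suc e) _ λ y _ →
         vanish (c + y ∷ v) (v≱c ∘ All.tail)) ⟩
  ∑[ s ∈ listsUpTo k e ] ∑[ y < suc e ] F (c + y ∷ map (c +_) s)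
    ≡⟨ ∑-listsUpTo-suc k e _ ⟨
  ∑[ s ∈ listsUpTo (suc k) e ] F (map (c +_) s)               ∎
  where
  open ≡-Reasoning
  drop-low : ∀ v → ∑< c (λ x → F (x ∷ v)) + ∑[ y < suc e ] F (c + y ∷ v) ≡ ∑[ y < suc e ] F (c + y ∷ v)
  drop-low v = cong (_+ ∑[ y < suc e ] F (c + y ∷ v)) (∑<-zero c _ λ x x<c →
                 vanish (x ∷ v) (<⇒≱ x<c ∘ All.head))

-- The statistics on lists, where concatenation is at hand

minL : List ℕ → ℕ
minL [] = 0
minL (x ∷ xs) = foldr _⊓_ x xs

sucPos : ℕ → ℕ
sucPos zero = zero
sucPos (suc k) = suc (suc k)

lastIndexOfˡ : ℕ → List ℕ → ℕ
lastIndexOfˡ c [] = 0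
lastIndexOfˡ c (x ∷ xs) = (if x ≡ᵇ c then 1 else 0) ⊔ sucPos (lastIndexOfˡ c xs)

ascˡ : List ℕ → ℕ
ascˡ [] = 0
ascˡ (x ∷ []) = 0
ascˡ (x ∷ y ∷ ys) = (if x <ᵇ y then 1 else 0) + ascˡ (y ∷ ys)

contains21Above : ℕ → List ℕ → Bool
contains21Above x [] = false
contains21Above x (y ∷ ys) = any (λ z → (x <ᵇ z) ∧ (z <ᵇ y)) ys ∨ contains21Above x ys

contains021ˡ : List ℕ → Bool
contains021ˡ [] = false
contains021ˡ (x ∷ xs) = contains21Above x xs ∨ contains021ˡ xs

isLSˡ isSLˡ : List ℕ → Bool
isLSˡ w = lastIndexOfˡ (maxL w) w <ᵇ lastIndexOfˡ (minL w) w
isSLˡ w = lastIndexOfˡ (minL w) w <ᵇ suc (lastIndexOfˡ (maxL w) w)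

-- From vectors to lists

map-allFin-suc : ∀ {A : Set} n (g : Fin (suc n) → A) → map g (allFin (suc n)) ≡ g fzero ∷ map (g ∘ fsuc) (allFin n)
map-allFin-suc n g = trans (map-tabulate id g) (cong (g fzero ∷_) (sym (map-tabulate id (g ∘ fsuc))))

values-toList : ∀ {n} (w : Vec ℕ n) → values w ≡ toList w
values-toList [] = refl
values-toList {suc n} (x ∷ w) = trans (map-allFin-suc n (lookup (x ∷ w))) (cong (x ∷_) (values-toList w))

lar-toList : ∀ {n} (w : Vec ℕ n) → lar w ≡ maxL (toList w)
lar-toList w = cong maxL (values-toList w)

sma-toList : ∀ {n} (w : Vec ℕ n) → sma w ≡ minL (toList w)
sma-toList [] = refl
sma-toList (x ∷ w) = cong (foldr _⊓_ x) (values-toList w)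

asc-toList : ∀ {n} (w : Vec ℕ n) → asc w ≡ ascˡ (toList w)
asc-toList [] = refl
asc-toList (x ∷ []) = refl
asc-toList (x ∷ y ∷ w) = cong (_ +_) (asc-toList (y ∷ w))

lastIndexOf-toList : ∀ {n} c (w : Vec ℕ n) → lastIndexOf c w ≡ lastIndexOfˡ c (toList w)
lastIndexOf-toList c [] = refl
lastIndexOf-toList {suc n} c (x ∷ w) = begin
  lastIndexOf c (x ∷ w)                                    ≡⟨ cong maxL (map-allFin-suc n _) ⟩
  (if x ≡ᵇ c then 1 else 0) ⊔ maxL (map (index ∘ fsuc) (allFin n))
    ≡⟨ cong (λ is → _ ⊔ maxL is) (trans (map-cong sucPos-index (allFin n)) (map-∘ (allFin n))) ⟩
  (if x ≡ᵇ c then 1 else 0) ⊔ maxL (map sucPos (map index′ (allFin n)))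
    ≡⟨ cong (_ ⊔_) (maxL-map-sucPos (map index′ (allFin n))) ⟩
  (if x ≡ᵇ c then 1 else 0) ⊔ sucPos (lastIndexOf c w)     ≡⟨ cong (λ k → _ ⊔ sucPos k) (lastIndexOf-toList c w) ⟩
  lastIndexOfˡ c (toList (x ∷ w))                        ∎
  where
  open ≡-Reasoning
  index : Fin (suc n) → ℕ
  index i = if lookup (x ∷ w) i ≡ᵇ c then suc (toℕ i) else 0
  index′ : Fin n → ℕ
  index′ i = if lookup w i ≡ᵇ c then suc (toℕ i) else 0
  sucPos-index : ∀ i → index (fsuc i) ≡ sucPos (index′ i)
  sucPos-index i with lookup w i ≡ᵇ c
  ... | true = refl
  ... | false = refl
  maxL-map-sucPos : ∀ ks → maxL (map sucPos ks) ≡ sucPos (maxL ks)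
  maxL-map-sucPos [] = refl
  maxL-map-sucPos (k ∷ ks) = trans (cong (sucPos k ⊔_) (maxL-map-sucPos ks)) (sucPos-⊔ k (maxL ks))
    where
    sucPos-⊔ : ∀ k l → sucPos k ⊔ sucPos l ≡ sucPos (k ⊔ l)
    sucPos-⊔ zero l = refl
    sucPos-⊔ (suc k) zero = refl
    sucPos-⊔ (suc k) (suc l) = refl

any-allFin-suc : ∀ n (p : Fin (suc n) → Bool) → any p (allFin (suc n)) ≡ p fzero ∨ any (p ∘ fsuc) (allFin n)
any-allFin-suc n p = cong or (map-allFin-suc n p)

any-allFin-cong : ∀ n {p q : Fin n → Bool} → (∀ i → p i ≡ q i) → any p (allFin n) ≡ any q (allFin n)
any-allFin-cong n eq = cong or (map-cong eq (allFin n))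

any-allFin-false : ∀ n → any (λ (_ : Fin n) → false) (allFin n) ≡ false
any-allFin-false zero = refl
any-allFin-false (suc n) = trans (any-allFin-suc n (λ _ → false)) (any-allFin-false n)

any-lookup-toList : ∀ {n} (q : ℕ → Bool) (w : Vec ℕ n) → any (q ∘ lookup w) (allFin n) ≡ any q (toList w)
any-lookup-toList q [] = refl
any-lookup-toList {suc n} q (x ∷ w) = trans (any-allFin-suc n _) (cong (q x ∨_) (any-lookup-toList q w))

contains21Aboveᵛ : ∀ {n} → ℕ → Vec ℕ n → Bool
contains21Aboveᵛ {n} x w =
  any (λ j → any (λ k → (toℕ j <ᵇ toℕ k) ∧ (x <ᵇ lookup w k) ∧ (lookup w k <ᵇ lookup w j))
      (allFin n)) (allFin n)

contains21Aboveᵛ-toList : ∀ {n} x (w : Vec ℕ n) → contains21Aboveᵛ x w ≡ contains21Above x (toList w)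
contains21Aboveᵛ-toList x [] = refl
contains21Aboveᵛ-toList {suc n} x (y ∷ w) = begin
  contains21Aboveᵛ x (y ∷ w)
    ≡⟨ trans (any-allFin-suc n (λ j → any (body j) (allFin (suc n))))
             (cong₂ _∨_ (any-allFin-suc n (body fzero))
                        (any-allFin-cong n λ j → any-allFin-suc n (body (fsuc j)))) ⟩
  any (λ k → (x <ᵇ lookup w k) ∧ (lookup w k <ᵇ y)) (allFin n) ∨ contains21Aboveᵛ x w
    ≡⟨ cong₂ _∨_ (any-lookup-toList (λ z → (x <ᵇ z) ∧ (z <ᵇ y)) w) (contains21Aboveᵛ-toList x w) ⟩
  contains21Above x (toList (y ∷ w))        ∎
  where
  open ≡-Reasoning
  body : Fin (suc n) → Fin (suc n) → Bool
  body j k = (toℕ j <ᵇ toℕ k) ∧ (x <ᵇ lookup (y ∷ w) k) ∧ (lookup (y ∷ w) k <ᵇ lookup (y ∷ w) j)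

contains021-∷ : ∀ {n} x (w : Vec ℕ n) → contains021 (x ∷ w) ≡ contains21Aboveᵛ x w ∨ contains021 w
contains021-∷ {n} x w = begin
  contains021 (x ∷ w)
    ≡⟨ any-allFin-suc n (λ i → any (λ j → any (body i j) (allFin (suc n))) (allFin (suc n))) ⟩
  any (λ j → any (body fzero j) (allFin (suc n))) (allFin (suc n)) ∨
    any (λ i → any (λ j → any (body (fsuc i) j) (allFin (suc n))) (allFin (suc n))) (allFin n)
    ≡⟨ cong₂ _∨_ first rest ⟩
  contains21Aboveᵛ x w ∨ contains021 w        ∎
  where
  open ≡-Reasoning
  body : Fin (suc n) → Fin (suc n) → Fin (suc n) → Bool
  body i j k = (toℕ i <ᵇ toℕ j) ∧ (toℕ j <ᵇ toℕ k)
               ∧ (lookup (x ∷ w) i <ᵇ lookup (x ∷ w) k) ∧ (lookup (x ∷ w) k <ᵇ lookup (x ∷ w) j)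
  first : any (λ j → any (body fzero j) (allFin (suc n))) (allFin (suc n)) ≡ contains21Aboveᵛ x w
  first = trans (any-allFin-suc n (λ j → any (body fzero j) (allFin (suc n))))
            (cong₂ _∨_ (any-allFin-false (suc n)) (any-allFin-cong n λ j → any-allFin-suc n (body fzero (fsuc j))))
  rest : any (λ i → any (λ j → any (body (fsuc i) j) (allFin (suc n))) (allFin (suc n))) (allFin n)
         ≡ contains021 w
  rest = any-allFin-cong n λ i → trans (any-allFin-suc n (λ j → any (body (fsuc i) j) (allFin (suc n))))
           (cong₂ _∨_ (any-allFin-false (suc n)) (any-allFin-cong n λ j →
             trans (any-allFin-suc n (body (fsuc i) (fsuc j)))
                   (cong (_∨ any (body (fsuc i) (fsuc j) ∘ fsuc) (allFin n)) (∧-zeroʳ (toℕ i <ᵇ toℕ j)))))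

contains021-toList : ∀ {n} (w : Vec ℕ n) → contains021 w ≡ contains021ˡ (toList w)
contains021-toList [] = refl
contains021-toList (x ∷ w) =
  trans (contains021-∷ x w) (cong₂ _∨_ (contains21Aboveᵛ-toList x w) (contains021-toList w))

lastIndexOf-toList-at : ∀ {n c d} (w : Vec ℕ n) → c ≡ d → lastIndexOf c w ≡ lastIndexOfˡ d (toList w)
lastIndexOf-toList-at {c = c} w refl = lastIndexOf-toList c w

isLS-toList : ∀ {n} (w : Vec ℕ n) → isLS w ≡ isLSˡ (toList w)
isLS-toList w = cong₂ _<ᵇ_ (lastIndexOf-toList-at w (lar-toList w)) (lastIndexOf-toList-at w (sma-toList w))

isSL-toList : ∀ {n} (w : Vec ℕ n) → isSL w ≡ isSLˡ (toList w)
isSL-toList w = cong₂ (λ i j → i <ᵇ suc j) (lastIndexOf-toList-at w (sma-toList w)) (lastIndexOf-toList-at w (lar-toList w))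

counted : ℕ → ℕ → List ℕ → Bool
counted a b w = (maxL w ≡ᵇ a) ∧ (ascˡ w ≡ᵇ b) ∧ not (contains021ˡ w)

count-∑ : ∀ {A : Set} (p : A → Bool) xs → count p xs ≡ ∑[ x ∈ xs ] 𝟙 (p x)
count-∑ p [] = refl
count-∑ p (x ∷ xs) with p x
... | true = cong suc (count-∑ p xs)
... | false = count-∑ p xs

-- The factor not (null w) accounts for the missing x⁰ terms (coeff P 0 a b = 0).
coeff-as-∑ : (P : ∀ {n} → Vec ℕ n → Bool) (Pˡ : List ℕ → Bool) →
             (∀ {n} (w : Vec ℕ n) → P w ≡ Pˡ (toList w)) →
             ∀ n a b → coeff P n a b ≡ ∑[ w ∈ listsUpTo n a ] 𝟙 (not (null w) ∧ Pˡ w ∧ counted a b w)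
coeff-as-∑ P Pˡ P≡Pˡ zero a b = refl
coeff-as-∑ P Pˡ P≡Pˡ (suc n) a b = begin
  coeff P (suc n) a b                                          ≡⟨ count-∑ _ (vecsUpTo (suc n) a) ⟩
  ∑[ w ∈ vecsUpTo (suc n) a ] 𝟙 (P w ∧ (lar w ≡ᵇ a) ∧ (asc w ≡ᵇ b) ∧ not (contains021 w))
    ≡⟨ ∑-cong (vecsUpTo (suc n) a) (λ w → cong 𝟙 (cong₂ _∧_ (P≡Pˡ w)
         (cong₂ _∧_ (cong (_≡ᵇ a) (lar-toList w))
           (cong₂ _∧_ (cong (_≡ᵇ b) (asc-toList w)) (cong not (contains021-toList w)))))) ⟩
  ∑[ w ∈ vecsUpTo (suc n) a ] 𝟙 (Pˡ (toList w) ∧ counted a b (toList w))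
    ≡⟨ ∑-vecsUpTo (suc n) a (λ w → 𝟙 (Pˡ w ∧ counted a b w)) ⟩
  ∑[ w ∈ listsUpTo (suc n) a ] 𝟙 (Pˡ w ∧ counted a b w)
    ≡⟨ listsUpTo-cong (suc n) a (λ { (_ ∷ _) _ _ → refl }) ⟩
  ∑[ w ∈ listsUpTo (suc n) a ] 𝟙 (not (null w) ∧ Pˡ w ∧ counted a b w) ∎
  where open ≡-Reasoning

-- Maxima, last occurrences and 021-avoidance

_≽_ : List ℕ → List ℕ → Set
xs ≽ ys = ∀ {x y} → x ∈ xs → y ∈ ys → y ≤ x

maxL-++ : ∀ xs ys → maxL (xs ++ ys) ≡ maxL xs ⊔ maxL ys
maxL-++ [] ys = refl
maxL-++ (x ∷ xs) ys = trans (cong (x ⊔_) (maxL-++ xs ys)) (sym (⊔-assoc x (maxL xs) (maxL ys)))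

∈⇒≤maxL : ∀ {x xs} → x ∈ xs → x ≤ maxL xs
∈⇒≤maxL {xs = y ∷ ys} (here refl) = m≤m⊔n y (maxL ys)
∈⇒≤maxL {xs = y ∷ ys} (there x∈ys) = ≤-trans (∈⇒≤maxL x∈ys) (m≤n⊔m y (maxL ys))

maxL-∈ : ∀ x xs → maxL (x ∷ xs) ∈ x ∷ xs
maxL-∈ x [] = here (⊔-identityʳ x)
maxL-∈ x (y ∷ ys) with ⊔-sel x (maxL (y ∷ ys))
... | inj₁ eq = here eq
... | inj₂ eq = there (subst (_∈ y ∷ ys) (sym eq) (maxL-∈ y ys))

minL-≤ : ∀ {y} ws → y ∈ ws → minL ws ≤ y
minL-≤ (x ∷ xs) (here refl) = foldr-⊓-≤-init x xs
  where
  foldr-⊓-≤-init : ∀ x xs → foldr _⊓_ x xs ≤ x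
  foldr-⊓-≤-init x [] = ≤-refl
  foldr-⊓-≤-init x (y ∷ ys) = ≤-trans (m⊓n≤n y _) (foldr-⊓-≤-init x ys)
minL-≤ (x ∷ xs) (there y∈xs) = foldr-⊓-≤ x xs y∈xs
  where
  foldr-⊓-≤ : ∀ x xs {y} → y ∈ xs → foldr _⊓_ x xs ≤ y
  foldr-⊓-≤ x (z ∷ zs) (here refl) = m⊓n≤m z _
  foldr-⊓-≤ x (z ∷ zs) (there y∈zs) = ≤-trans (m⊓n≤n z _) (foldr-⊓-≤ x zs y∈zs)

minL-∈ : ∀ x xs → minL (x ∷ xs) ∈ x ∷ xs
minL-∈ x [] = here refl
minL-∈ x (y ∷ ys) with ⊓-sel y (foldr _⊓_ x ys)
... | inj₁ eq = there (here eq)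
... | inj₂ eq with minL-∈ x ys
...   | here eq′ = here (trans eq eq′)
...   | there m∈ys = there (there (subst (_∈ ys) (sym eq) m∈ys))

minL-∈-lower : ∀ xs y ys → xs ≽ (y ∷ ys) → minL (xs ++ y ∷ ys) ∈ y ∷ ys
minL-∈-lower [] y ys _ = minL-∈ y ys
minL-∈-lower (x ∷ xs) y ys xs≽ with ∈-++⁻ (x ∷ xs) (minL-∈ x (xs ++ y ∷ ys))
... | inj₂ m∈lower = m∈lower
... | inj₁ m∈upper = here (≤-antisym (minL-≤ (x ∷ xs ++ y ∷ ys) (∈-++⁺ʳ (x ∷ xs) (here refl)))
                                     (xs≽ m∈upper (here refl)))

indicator≤1 : ∀ b → (if b then 1 else 0) ≤ 1
indicator≤1 true = ≤-refl
indicator≤1 false = z≤n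

lastIndexOf-∉ : ∀ c ys → c ∉ ys → lastIndexOfˡ c ys ≡ 0
lastIndexOf-∉ c [] _ = refl
lastIndexOf-∉ c (y ∷ ys) c∉ rewrite dec-false (y ≟ c) (λ { refl → c∉ (here refl) })
                                  | lastIndexOf-∉ c ys (c∉ ∘ there) = refl

lastIndexOf-∈ : ∀ c ys → c ∈ ys → 1 ≤ lastIndexOfˡ c ys
lastIndexOf-∈ c (y ∷ ys) (here refl) rewrite dec-true (c ≟ c) refl = m≤m⊔n 1 (sucPos (lastIndexOfˡ c ys))
lastIndexOf-∈ c (y ∷ ys) (there c∈ys) with lastIndexOfˡ c ys | lastIndexOf-∈ c ys c∈ys
... | suc k | _ = ≤-trans (s≤s z≤n) (m≤n⊔m (if y ≡ᵇ c then 1 else 0) (suc (suc k)))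

lastIndexOf≤length : ∀ c ys → lastIndexOfˡ c ys ≤ length ys
lastIndexOf≤length c [] = z≤n
lastIndexOf≤length c (y ∷ ys) =
  ⊔-lub (≤-trans (indicator≤1 (y ≡ᵇ c)) (s≤s z≤n)) (sucPos≤suc (lastIndexOf≤length c ys))
  where
  sucPos≤suc : ∀ {k} → k ≤ length ys → sucPos k ≤ suc (length ys)
  sucPos≤suc {zero} _ = z≤n
  sucPos≤suc {suc k} k≤ = s≤s k≤

lastIndexOf-++-∉ : ∀ c xs ys → c ∉ ys → lastIndexOfˡ c (xs ++ ys) ≡ lastIndexOfˡ c xs
lastIndexOf-++-∉ c [] ys c∉ = lastIndexOf-∉ c ys c∉
lastIndexOf-++-∉ c (x ∷ xs) ys c∉ = cong (λ k → _ ⊔ sucPos k) (lastIndexOf-++-∉ c xs ys c∉)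

lastIndexOf-++-∈ : ∀ c xs ys → c ∈ ys → lastIndexOfˡ c (xs ++ ys) ≡ length xs + lastIndexOfˡ c ys
lastIndexOf-++-∈ c [] ys c∈ = refl
lastIndexOf-++-∈ c (x ∷ xs) ys c∈ rewrite lastIndexOf-++-∈ c xs ys c∈
  with length xs + lastIndexOfˡ c ys | m≤n⇒m≤o+n (length xs) (lastIndexOf-∈ c ys c∈)
... | suc k | _ = m≤n⇒m⊔n≡n (≤-trans (indicator≤1 (x ≡ᵇ c)) (s≤s z≤n))

lastIndexOf-∷ʳ : ∀ c xs → lastIndexOfˡ c (xs ++ [ c ]) ≡ length (xs ++ [ c ])
lastIndexOf-∷ʳ c xs rewrite lastIndexOf-++-∈ c xs [ c ] (here refl) | dec-true (c ≟ c) refl = sym (length-++ xs)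

module _ (p : ℕ → Bool) where

  any-++ : ∀ xs ys → any p (xs ++ ys) ≡ any p xs ∨ any p ys
  any-++ [] ys = refl
  any-++ (x ∷ xs) ys = trans (cong (p x ∨_) (any-++ xs ys)) (sym (∨-assoc (p x) _ _))

  any-false : ∀ zs → (∀ {z} → z ∈ zs → p z ≡ false) → any p zs ≡ false
  any-false [] _ = refl
  any-false (z ∷ zs) none rewrite none (here refl) = any-false zs (none ∘ there)

  any-true : ∀ {z} zs → z ∈ zs → p z ≡ true → any p zs ≡ true
  any-true (z ∷ zs) (here refl) pz rewrite pz = refl
  any-true (z ∷ zs) (there z∈zs) pz = trans (cong (p z ∨_) (any-true zs z∈zs pz)) (∨-zeroʳ (p z))

contains21Above-≤ : ∀ x ys → (∀ {y} → y ∈ ys → y ≤ x) → contains21Above x ys ≡ false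
contains21Above-≤ x [] _ = refl
contains21Above-≤ x (y ∷ ys) ys≤x
  rewrite any-false (λ z → (x <ᵇ z) ∧ (z <ᵇ y)) ys
            (λ {z} z∈ys → cong (_∧ (z <ᵇ y)) (dec-false (x <? z) (≤⇒≯ (ys≤x (there z∈ys)))))
  = contains21Above-≤ x ys (ys≤x ∘ there)

contains21Above-++-≤ : ∀ x r ys → (∀ {y} → y ∈ ys → y ≤ x) → contains21Above x (r ++ ys) ≡ contains21Above x r
contains21Above-++-≤ x [] ys ys≤x = contains21Above-≤ x ys ys≤x
contains21Above-++-≤ x (y ∷ r) ys ys≤x = cong₂ _∨_ any-prefix (contains21Above-++-≤ x r ys ys≤x)
  where
  q : ℕ → Bool
  q z = (x <ᵇ z) ∧ (z <ᵇ y)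
  any-prefix : any q (r ++ ys) ≡ any q r
  any-prefix = trans (any-++ q r ys) (trans (cong (any q r ∨_)
                 (any-false q ys (λ {z} z∈ys → cong (_∧ (z <ᵇ y)) (dec-false (x <? z) (≤⇒≯ (ys≤x z∈ys))))))
                 (∨-identityʳ _))

contains021-++ : ∀ xs ys → xs ≽ ys → contains021ˡ (xs ++ ys) ≡ contains021ˡ xs ∨ contains021ˡ ys
contains021-++ [] ys _ = refl
contains021-++ (x ∷ xs) ys xs≽ys = trans
  (cong₂ _∨_ (contains21Above-++-≤ x xs ys (xs≽ys (here refl))) (contains021-++ xs ys (xs≽ys ∘ there)))
  (sym (∨-assoc (contains21Above x xs) _ _))

contains21Above-++ˡ : ∀ x xs ys → contains21Above x (xs ++ ys) ≡ false → contains21Above x xs ≡ false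
contains21Above-++ˡ x [] ys _ = refl
contains21Above-++ˡ x (y ∷ xs) ys avoid = cong₂ _∨_
  (∨-conicalˡ (any q xs) _ (trans (sym (any-++ q xs ys)) (∨-conicalˡ _ _ avoid)))
  (contains21Above-++ˡ x xs ys (∨-conicalʳ _ _ avoid))
  where
  q : ℕ → Bool
  q z = (x <ᵇ z) ∧ (z <ᵇ y)

avoids-++ˡ : ∀ xs ys → contains021ˡ (xs ++ ys) ≡ false → contains021ˡ xs ≡ false
avoids-++ˡ [] ys _ = refl
avoids-++ˡ (x ∷ xs) ys avoid = cong₂ _∨_
  (contains21Above-++ˡ x xs ys (∨-conicalˡ _ _ avoid)) (avoids-++ˡ xs ys (∨-conicalʳ _ _ avoid))

avoids-++ʳ : ∀ xs ys → contains021ˡ (xs ++ ys) ≡ false → contains021ˡ ys ≡ false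
avoids-++ʳ [] ys avoid = avoid
avoids-++ʳ (x ∷ xs) ys avoid = avoids-++ʳ xs ys (∨-conicalʳ _ _ avoid)

contains021-peak : ∀ t M u {x y} → x ∈ t → y ∈ u → x < y → y < M → contains021ˡ (t ++ M ∷ u) ≡ true
contains021-peak (x ∷ t) M u (here refl) y∈u x<y y<M = cong (_∨ _) (above t)
  where
  above : ∀ t → contains21Above x (t ++ M ∷ u) ≡ true
  above [] = cong (_∨ _) (any-true (λ z → (x <ᵇ z) ∧ (z <ᵇ M)) u y∈u
               (cong₂ _∧_ (dec-true (x <? _) x<y) (dec-true (_ <? M) y<M)))
  above (z ∷ t) = trans (cong (any (λ w → (x <ᵇ w) ∧ (w <ᵇ z)) (t ++ M ∷ u) ∨_) (above t)) (∨-zeroʳ _)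
contains021-peak (z ∷ t) M u (there x∈t) y∈u x<y y<M =
  trans (cong (contains21Above z (t ++ M ∷ u) ∨_) (contains021-peak t M u x∈t y∈u x<y y<M)) (∨-zeroʳ _)

ascˡ-++ : ∀ xs ys → xs ≽ ys → ascˡ (xs ++ ys) ≡ ascˡ xs + ascˡ ys
ascˡ-++ [] ys _ = refl
ascˡ-++ (x ∷ []) [] _ = refl
ascˡ-++ (x ∷ []) (y ∷ ys) x≽ rewrite dec-false (x <? y) (≤⇒≯ (x≽ (here refl) (here refl))) = refl
ascˡ-++ (x ∷ x′ ∷ xs) ys xs≽ys =
  trans (cong (_ +_) (ascˡ-++ (x′ ∷ xs) ys (xs≽ys ∘ there))) (sym (+-assoc (if x <ᵇ x′ then 1 else 0) _ _))

-- Cutting an LS word after its last maximum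

take-++-length : ∀ {A : Set} {k} (s v : List A) → length s ≡ k → take k (s ++ v) ≡ s
take-++-length [] v refl = refl
take-++-length (x ∷ s) v refl = cong (x ∷_) (take-++-length s v refl)

drop-++-length : ∀ {A : Set} {k} (s v : List A) → length s ≡ k → drop k (s ++ v) ≡ v
drop-++-length [] v refl = refl
drop-++-length (x ∷ s) v refl = drop-++-length s v refl

lastOccurrence : ∀ c w → c ∈ w → ∃₂ λ t u → w ≡ t ++ c ∷ u × c ∉ u
lastOccurrence c (x ∷ xs) c∈w with c ∈? xs
... | yes c∈xs with lastOccurrence c xs c∈xs
...   | t , u , refl , c∉u = x ∷ t , u , refl , c∉u
lastOccurrence c (x ∷ xs) (here refl) | no c∉xs = [] , xs , refl , c∉xs
lastOccurrence c (x ∷ xs) (there c∈xs) | no c∉xs = ⊥-elim (c∉xs c∈xs)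

peak-separates : ∀ t M u → contains021ˡ (t ++ M ∷ u) ≡ false → (∀ {y} → y ∈ u → y < M) → (t ++ [ M ]) ≽ u
peak-separates t M u avoid u<M {x} x∈ y∈u with ∈-++⁻ t x∈
... | inj₂ (here refl) = <⇒≤ (u<M y∈u)
... | inj₁ x∈t = ≮⇒≥ λ x<y → case trans (sym (contains021-peak t M u x∈t y∈u x<y (u<M y∈u))) avoid of λ ()

splitAtLastMax : ∀ w → w ≢ [] → contains021ˡ w ≡ false →
  ∃₂ λ t u → w ≡ (t ++ [ maxL w ]) ++ u × (t ++ [ maxL w ]) ≽ u × (∀ {y} → y ∈ u → y < maxL w)
splitAtLastMax [] w≢[] _ = ⊥-elim (w≢[] refl)
splitAtLastMax w@(x ∷ xs) _ avoid with lastOccurrence (maxL w) w (maxL-∈ x xs)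
... | t , u , w≡ , M∉u = t , u , trans w≡ (sym (++-assoc t _ u)) ,
                         peak-separates t (maxL w) u (subst (λ w′ → contains021ˡ w′ ≡ false) w≡ avoid) u<M , u<M
  where
  u<M : ∀ {y} → y ∈ u → y < maxL w
  u<M y∈u = ≤∧≢⇒< (∈⇒≤maxL (subst (_ ∈_) (sym w≡) (∈-++⁺ʳ t (there y∈u)))) λ { refl → M∉u y∈u }

lastIndexOf-lastMax : ∀ s M u → (∀ {y} → y ∈ u → y < M) → lastIndexOfˡ M ((s ++ [ M ]) ++ u) ≡ length (s ++ [ M ])
lastIndexOf-lastMax s M u u<M = trans (lastIndexOf-++-∉ M (s ++ [ M ]) u λ M∈u → <-irrefl refl (u<M M∈u))
                                      (lastIndexOf-∷ʳ M s)

length<lastIndexOf-min : ∀ s y u → s ≽ (y ∷ u) → length s < lastIndexOfˡ (minL (s ++ y ∷ u)) (s ++ y ∷ u)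
length<lastIndexOf-min s y u s≽ = begin-strict
  length s                                  <⟨ n<1+n (length s) ⟩
  suc (length s)                            ≡⟨ +-comm 1 (length s) ⟩
  length s + 1                              ≤⟨ +-monoʳ-≤ (length s) (lastIndexOf-∈ m (y ∷ u) m∈) ⟩
  length s + lastIndexOfˡ m (y ∷ u)         ≡⟨ lastIndexOf-++-∈ m s (y ∷ u) m∈ ⟨
  lastIndexOfˡ m (s ++ y ∷ u)               ∎
  where
  open ≤-Reasoning
  m = minL (s ++ y ∷ u)
  m∈ = minL-∈-lower s y u s≽

SL-avoiding-endsWithMax : ∀ w → w ≢ [] → isSLˡ w ≡ true → contains021ˡ w ≡ false →
                          lastIndexOfˡ (maxL w) w ≡ length w
SL-avoiding-endsWithMax w w≢[] sl avoid with splitAtLastMax w w≢[] avoid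
... | t , [] , w≡ , _ , u<M = begin
  lastIndexOfˡ (maxL w) w                          ≡⟨ cong (lastIndexOfˡ (maxL w)) w≡ ⟩
  lastIndexOfˡ (maxL w) ((t ++ [ maxL w ]) ++ [])  ≡⟨ lastIndexOf-lastMax t (maxL w) [] u<M ⟩
  length (t ++ [ maxL w ])                         ≡⟨ cong length (++-identityʳ (t ++ [ maxL w ])) ⟨
  length ((t ++ [ maxL w ]) ++ [])                 ≡⟨ cong length w≡ ⟨
  length w                                         ∎
  where open ≡-Reasoning
... | t , y ∷ u , w≡ , s≽u , u<M =
  ⊥-elim (<⇒≱ (subst (λ w′ → lastIndexOfˡ (maxL w) w′ < lastIndexOfˡ (minL w′) w′) (sym w≡) lastMax<lastMin)
              (s≤s⁻¹ (does⇒ (_ <? _) sl)))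
  where
  s = t ++ [ maxL w ]
  lastMax<lastMin : lastIndexOfˡ (maxL w) (s ++ y ∷ u) < lastIndexOfˡ (minL (s ++ y ∷ u)) (s ++ y ∷ u)
  lastMax<lastMin = subst (_< lastIndexOfˡ (minL (s ++ y ∷ u)) (s ++ y ∷ u))
                          (sym (lastIndexOf-lastMax t (maxL w) (y ∷ u) u<M)) (length<lastIndexOf-min s y u s≽u)

record LSSplit (s v : List ℕ) : Set where
  field
    v≢[]     : v ≢ []
    s≥maxv   : All (maxL v ≤_) s
    maxv<maxs : maxL v < maxL s
    s-SL     : isSLˡ s ≡ true
    s-avoids : contains021ˡ s ≡ false
    v-avoids : contains021ˡ v ≡ false

  s≽v : s ≽ v
  s≽v x∈s y∈v = ≤-trans (∈⇒≤maxL y∈v) (All.lookup s≥maxv x∈s)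

  maxs∉v : maxL s ∉ v
  maxs∉v maxs∈v = <⇒≱ maxv<maxs (∈⇒≤maxL maxs∈v)

  maxL-s++v : maxL (s ++ v) ≡ maxL s
  maxL-s++v = trans (maxL-++ s v) (m≥n⇒m⊔n≡m (<⇒≤ maxv<maxs))

  s≢[] : s ≢ []
  s≢[] refl = <⇒≱ maxv<maxs z≤n

isLSTail : List ℕ → Bool
isLSTail v = not (null v) ∧ not (contains021ˡ v)

isLSHead : ℕ → List ℕ → Bool
isLSHead c s = does (all? (c ≤?_) s) ∧ (c <ᵇ maxL s) ∧ isSLˡ s ∧ not (contains021ˡ s)

isLSSplit : List ℕ → List ℕ → Bool
isLSSplit s v = isLSTail v ∧ isLSHead (maxL v) s

isLSSplit⇒LSSplit : ∀ s v → isLSSplit s v ≡ true → LSSplit s v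
isLSSplit⇒LSSplit s [] ()
isLSSplit⇒LSSplit s v@(_ ∷ _) split = record
  { v≢[] = λ ()
  ; s≥maxv = does⇒ (all? _ s) (∧-conicalˡ A _ head)
  ; maxv<maxs = does⇒ (_ <? _) (∧-conicalˡ B _ head₂)
  ; s-SL = ∧-conicalˡ (isSLˡ s) _ head₃
  ; s-avoids = not-injective (∧-conicalʳ (isSLˡ s) _ head₃)
  ; v-avoids = not-injective (∧-conicalˡ (not (contains021ˡ v)) _ split)
  }
  where
  A = does (all? (maxL v ≤?_) s)
  B = maxL v <ᵇ maxL s
  head = ∧-conicalʳ (not (contains021ˡ v)) _ split
  head₂ = ∧-conicalʳ A _ head
  head₃ = ∧-conicalʳ B _ head₂

LSSplit⇒isLSSplit : ∀ s v → LSSplit s v → isLSSplit s v ≡ true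
LSSplit⇒isLSSplit s [] split = ⊥-elim (LSSplit.v≢[] split refl)
LSSplit⇒isLSSplit s (y ∷ v) split
  rewrite LSSplit.v-avoids split
        | dec-true (all? (maxL (y ∷ v) ≤?_) s) (LSSplit.s≥maxv split)
        | dec-true (_ <? maxL s) (LSSplit.maxv<maxs split)
        | LSSplit.s-SL split | LSSplit.s-avoids split = refl

LSSplit⇒LS : ∀ {s v} → LSSplit s v → isLSˡ (s ++ v) ∧ not (contains021ˡ (s ++ v)) ≡ true
LSSplit⇒LS {s} {y ∷ v} split = cong₂ _∧_ (dec-true (_ <? _) lastMax<lastMin)
  (cong not (trans (contains021-++ s (y ∷ v) s≽v) (cong₂ _∨_ s-avoids v-avoids)))
  where
  open LSSplit split
  lastMax<lastMin : lastIndexOfˡ (maxL (s ++ y ∷ v)) (s ++ y ∷ v) < lastIndexOfˡ (minL (s ++ y ∷ v)) (s ++ y ∷ v)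
  lastMax<lastMin = begin-strict
    lastIndexOfˡ (maxL (s ++ y ∷ v)) (s ++ y ∷ v) ≡⟨ cong (λ c → lastIndexOfˡ c (s ++ y ∷ v)) maxL-s++v ⟩
    lastIndexOfˡ (maxL s) (s ++ y ∷ v)            ≡⟨ lastIndexOf-++-∉ (maxL s) s (y ∷ v) maxs∉v ⟩
    lastIndexOfˡ (maxL s) s                       ≤⟨ lastIndexOf≤length (maxL s) s ⟩
    length s                                      <⟨ length<lastIndexOf-min s y v s≽v ⟩
    lastIndexOfˡ (minL (s ++ y ∷ v)) (s ++ y ∷ v) ∎
    where open ≤-Reasoning
LSSplit⇒LS {v = []} split = ⊥-elim (LSSplit.v≢[] split refl)

LSSplit⇒lastIndexOf-max : ∀ {s v} → LSSplit s v → lastIndexOfˡ (maxL (s ++ v)) (s ++ v) ≡ length s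
LSSplit⇒lastIndexOf-max {s} {v} split = begin
  lastIndexOfˡ (maxL (s ++ v)) (s ++ v) ≡⟨ cong (λ c → lastIndexOfˡ c (s ++ v)) maxL-s++v ⟩
  lastIndexOfˡ (maxL s) (s ++ v)        ≡⟨ lastIndexOf-++-∉ (maxL s) s v maxs∉v ⟩
  lastIndexOfˡ (maxL s) s               ≡⟨ SL-avoiding-endsWithMax s s≢[] s-SL s-avoids ⟩
  length s                              ∎
  where
  open ≡-Reasoning
  open LSSplit split

LS⇒LSSplit : ∀ w → isLSˡ w ∧ not (contains021ˡ w) ≡ true → ∃₂ λ s v → w ≡ s ++ v × LSSplit s v
LS⇒LSSplit [] ()
LS⇒LSSplit w@(_ ∷ _) ls-avoid with splitAtLastMax w (λ ()) (not-injective (∧-conicalʳ (isLSˡ w) _ ls-avoid))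
... | t , [] , w≡ , _ , u<M = ⊥-elim (<⇒≱ ls (begin
  lastIndexOfˡ (minL w) w                          ≤⟨ lastIndexOf≤length (minL w) w ⟩
  length w                                         ≡⟨ cong length w≡ ⟩
  length ((t ++ [ maxL w ]) ++ [])                 ≡⟨ cong length (++-identityʳ (t ++ [ maxL w ])) ⟩
  length (t ++ [ maxL w ])                         ≡⟨ lastIndexOf-lastMax t (maxL w) [] u<M ⟨
  lastIndexOfˡ (maxL w) ((t ++ [ maxL w ]) ++ [])  ≡⟨ cong (lastIndexOfˡ (maxL w)) w≡ ⟨
  lastIndexOfˡ (maxL w) w                          ∎))
  where
  open ≤-Reasoning
  ls = does⇒ (_ <? _) (∧-conicalˡ (isLSˡ w) _ ls-avoid)
... | t , u@(y ∷ _) , w≡ , s≽u , u<M = s , u , w≡ , record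
  { v≢[] = λ ()
  ; s≥maxv = All.tabulate λ x∈s → s≽u x∈s (maxL-∈ y _)
  ; maxv<maxs = subst (maxL u <_) (sym maxs≡M) (u<M (maxL-∈ y _))
  ; s-SL = dec-true (_ <? _) (s≤s (begin
      lastIndexOfˡ (minL s) s   ≤⟨ lastIndexOf≤length (minL s) s ⟩
      length s                  ≡⟨ lastIndexOf-∷ʳ (maxL w) t ⟨
      lastIndexOfˡ (maxL w) s   ≡⟨ cong (λ c → lastIndexOfˡ c s) maxs≡M ⟨
      lastIndexOfˡ (maxL s) s   ∎))
  ; s-avoids = avoids-++ˡ s u (subst (λ w′ → contains021ˡ w′ ≡ false) w≡ avoid)
  ; v-avoids = avoids-++ʳ s u (subst (λ w′ → contains021ˡ w′ ≡ false) w≡ avoid)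
  }
  where
  open ≤-Reasoning
  avoid = not-injective (∧-conicalʳ (isLSˡ w) _ ls-avoid)
  s = t ++ [ maxL w ]
  maxs≡M : maxL s ≡ maxL w
  maxs≡M = ≤-antisym (subst (maxL s ≤_) (trans (sym (maxL-++ s u)) (cong maxL (sym w≡))) (m≤m⊔n (maxL s) (maxL u)))
                     (∈⇒≤maxL (∈-++⁺ʳ t (here refl)))

∑-LSSplit-points : ∀ n w → length w ≡ n →
  ∑[ j < suc n ] 𝟙 (isLSSplit (take (n ∸ j) w) (drop (n ∸ j) w)) ≡ 𝟙 (isLSˡ w ∧ not (contains021ˡ w))
∑-LSSplit-points n w ∣w∣≡n with isLSˡ w ∧ not (contains021ˡ w) in ls-avoid
... | false = ∑<-zero (suc n) _ λ j _ → cong 𝟙 (no-split (n ∸ j))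
  where
  no-split : ∀ k → isLSSplit (take k w) (drop k w) ≡ false
  no-split k with isLSSplit (take k w) (drop k w) in split
  ... | false = refl
  ... | true = case trans (sym ls-avoid′) ls-avoid of λ ()
    where
    ls-avoid′ : isLSˡ w ∧ not (contains021ˡ w) ≡ true
    ls-avoid′ = subst (λ w′ → isLSˡ w′ ∧ not (contains021ˡ w′) ≡ true) (take++drop≡id k w)
                      (LSSplit⇒LS (isLSSplit⇒LSSplit (take k w) (drop k w) split))
... | true with LS⇒LSSplit w ls-avoid
...   | s , v , refl , split = ∑<-𝟙-unique (suc n) _ (s≤s ∣v∣≤n) split-at-∣v∣ unique
  where
  ∣s∣+∣v∣ : length s + length v ≡ n
  ∣s∣+∣v∣ = trans (sym (length-++ s)) ∣w∣≡n
  ∣v∣≤n : length v ≤ n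
  ∣v∣≤n = subst (length v ≤_) ∣s∣+∣v∣ (m≤n+m (length v) (length s))
  n∸∣v∣≡∣s∣ : n ∸ length v ≡ length s
  n∸∣v∣≡∣s∣ = trans (cong (_∸ length v) (sym ∣s∣+∣v∣)) (m+n∸n≡m (length s) (length v))
  split-at-∣v∣ : isLSSplit (take (n ∸ length v) (s ++ v)) (drop (n ∸ length v) (s ++ v)) ≡ true
  split-at-∣v∣ rewrite take-++-length s v (sym n∸∣v∣≡∣s∣) | drop-++-length s v (sym n∸∣v∣≡∣s∣) =
    LSSplit⇒isLSSplit s v split
  -- Any cut point lies right after the last maximum of w.
  unique : ∀ {j} → j < suc n → isLSSplit (take (n ∸ j) (s ++ v)) (drop (n ∸ j) (s ++ v)) ≡ true → j ≡ length v
  unique {j} j<1+n split-at-j = ∸-cancelˡ-≡ (s≤s⁻¹ j<1+n) ∣v∣≤n (begin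
    n ∸ j                                          ≡⟨ m≤n⇒m⊓n≡m (m∸n≤m n j) ⟨
    (n ∸ j) ⊓ n                                    ≡⟨ cong ((n ∸ j) ⊓_) ∣w∣≡n ⟨
    (n ∸ j) ⊓ length (s ++ v)                      ≡⟨ length-take (n ∸ j) (s ++ v) ⟨
    length (take (n ∸ j) (s ++ v))                 ≡⟨ LSSplit⇒lastIndexOf-max split-j ⟨
    lastIndexOfˡ (maxL w′) w′
      ≡⟨ cong (λ w → lastIndexOfˡ (maxL w) w) (take++drop≡id (n ∸ j) (s ++ v)) ⟩
    lastIndexOfˡ (maxL (s ++ v)) (s ++ v)          ≡⟨ LSSplit⇒lastIndexOf-max split ⟩
    length s                                       ≡⟨ n∸∣v∣≡∣s∣ ⟨
    n ∸ length v                                   ∎)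
    where
    open ≡-Reasoning
    w′ = take (n ∸ j) (s ++ v) ++ drop (n ∸ j) (s ++ v)
    split-j = isLSSplit⇒LSSplit (take (n ∸ j) (s ++ v)) (drop (n ∸ j) (s ++ v)) split-at-j

-- Shifting all letters

shift : ℕ → List ℕ → List ℕ
shift c = map (c +_)

≡ᵇ-shift : ∀ c x y → (c + x ≡ᵇ c + y) ≡ (x ≡ᵇ y)
≡ᵇ-shift zero x y = refl
≡ᵇ-shift (suc c) x y = ≡ᵇ-shift c x y

<ᵇ-shift : ∀ c x y → (c + x <ᵇ c + y) ≡ (x <ᵇ y)
<ᵇ-shift zero x y = refl
<ᵇ-shift (suc c) x y = <ᵇ-shift c x y

maxL-shift : ∀ c x s → maxL (shift c (x ∷ s)) ≡ c + maxL (x ∷ s)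
maxL-shift c x [] = trans (⊔-identityʳ (c + x)) (cong (c +_) (sym (⊔-identityʳ x)))
maxL-shift c x (y ∷ s) = trans (cong ((c + x) ⊔_) (maxL-shift c y s)) (sym (+-distribˡ-⊔ c x (maxL (y ∷ s))))

minL-shift : ∀ c x s → minL (shift c (x ∷ s)) ≡ c + minL (x ∷ s)
minL-shift c x [] = refl
minL-shift c x (y ∷ s) = trans (cong ((c + y) ⊓_) (minL-shift c x s)) (sym (+-distribˡ-⊓ c y (minL (x ∷ s))))

lastIndexOf-shift : ∀ c d s → lastIndexOfˡ (c + d) (shift c s) ≡ lastIndexOfˡ d s
lastIndexOf-shift c d [] = refl
lastIndexOf-shift c d (x ∷ s) =
  cong₂ (λ b k → (if b then 1 else 0) ⊔ sucPos k) (≡ᵇ-shift c x d) (lastIndexOf-shift c d s)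

ascˡ-shift : ∀ c s → ascˡ (shift c s) ≡ ascˡ s
ascˡ-shift c [] = refl
ascˡ-shift c (x ∷ []) = refl
ascˡ-shift c (x ∷ y ∷ s) = cong₂ (λ b k → (if b then 1 else 0) + k) (<ᵇ-shift c x y) (ascˡ-shift c (y ∷ s))

contains021-shift : ∀ c s → contains021ˡ (shift c s) ≡ contains021ˡ s
contains021-shift c [] = refl
contains021-shift c (x ∷ s) = cong₂ _∨_ (above s) (contains021-shift c s)
  where
  above : ∀ s → contains21Above (c + x) (shift c s) ≡ contains21Above x s
  above [] = refl
  above (y ∷ s) = cong₂ _∨_ (anyShift s) (above s)
    where
    anyShift : ∀ s → any (λ z → (c + x <ᵇ z) ∧ (z <ᵇ c + y)) (shift c s) ≡ any (λ z → (x <ᵇ z) ∧ (z <ᵇ y)) s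
    anyShift [] = refl
    anyShift (z ∷ s) = cong₂ _∨_ (cong₂ _∧_ (<ᵇ-shift c x z) (<ᵇ-shift c z y)) (anyShift s)

isSLˡ-shift : ∀ c s → isSLˡ (shift c s) ≡ isSLˡ s
isSLˡ-shift c [] = refl
isSLˡ-shift c (x ∷ s) = cong₂ (λ i j → i <ᵇ suc j)
  (trans (cong (λ d → lastIndexOfˡ d (shift c (x ∷ s))) (minL-shift c x s)) (lastIndexOf-shift c _ (x ∷ s)))
  (trans (cong (λ d → lastIndexOfˡ d (shift c (x ∷ s))) (maxL-shift c x s)) (lastIndexOf-shift c _ (x ∷ s)))

isLSHead-shift : ∀ c s → isLSHead c (shift c s) ≡ (0 <ᵇ maxL s) ∧ isSLˡ s ∧ not (contains021ˡ s)
isLSHead-shift c [] = refl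
isLSHead-shift c (x ∷ s) = cong₂ _∧_ above (cong₂ _∧_ (trans (cong (c <ᵇ_) (maxL-shift c x s)) positive)
                                           (cong₂ _∧_ (isSLˡ-shift c (x ∷ s)) (cong not (contains021-shift c (x ∷ s)))))
  where
  above : does (all? (c ≤?_) (shift c (x ∷ s))) ≡ true
  above = dec-true (all? _ _) (All-map⁺ (All.universal (m≤m+n c) (x ∷ s)))
  positive : (c <ᵇ c + maxL (x ∷ s)) ≡ (0 <ᵇ maxL (x ∷ s))
  positive = trans (cong (_<ᵇ c + maxL (x ∷ s)) (sym (+-identityʳ c))) (<ᵇ-shift c 0 _)

-- Counting

coefS⁺ : ℕ → ℕ → ℕ → ℕ
coefS⁺ k e b = 𝟙 (0 <ᵇ e) * coefS k e b

splitWeight : ℕ → ℕ → List ℕ → List ℕ → Bool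
splitWeight a b s v = isLSSplit s v ∧ (maxL s ≡ᵇ a) ∧ (ascˡ s + ascˡ v ≡ᵇ b)

𝟙-head-tail : ∀ t l c m e α β b →
  𝟙 ((t ∧ (0 <ᵇ m) ∧ l ∧ c) ∧ (m ≡ᵇ e) ∧ (α + β ≡ᵇ b))
  ≡ 𝟙 t * (𝟙 (β ≤ᵇ b) * (𝟙 (0 <ᵇ e) * 𝟙 (l ∧ (m ≡ᵇ e) ∧ (α ≡ᵇ b ∸ β) ∧ c)))
𝟙-head-tail t l c m e α β b = begin
  𝟙 ((t ∧ (0 <ᵇ m) ∧ l ∧ c) ∧ (m ≡ᵇ e) ∧ (α + β ≡ᵇ b))
    ≡⟨ trans (𝟙-∧ (t ∧ (0 <ᵇ m) ∧ l ∧ c) _) (cong₂ _*_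
         (trans (𝟙-∧ t _) (cong (T *_) (trans (𝟙-∧ (0 <ᵇ m) _) (cong (P *_) (𝟙-∧ l c)))))
         (𝟙-∧ (m ≡ᵇ e) _)) ⟩
  (T * (P * (L * C))) * (M * A)               ≡⟨ regroup T P L C M A ⟩
  T * L * C * (P * M) * A
    ≡⟨ cong₂ (λ pm a → T * L * C * pm * a) (𝟙-positive-≡ᵇ m e) (𝟙-+-≡ᵇ α β b) ⟩
  T * L * C * (E * M) * (Q * B)               ≡⟨ regroup′ T L C E M Q B ⟩
  T * (Q * (E * (L * (M * (B * C)))))
    ≡⟨ cong (λ z → T * (Q * (E * z)))
         (sym (trans (𝟙-∧ l _) (cong (L *_)
                (trans (𝟙-∧ (m ≡ᵇ e) _) (cong (M *_) (𝟙-∧ (α ≡ᵇ b ∸ β) c)))))) ⟩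
  T * (Q * (E * 𝟙 (l ∧ (m ≡ᵇ e) ∧ (α ≡ᵇ b ∸ β) ∧ c))) ∎
  where
  open ≡-Reasoning
  T = 𝟙 t
  P = 𝟙 (0 <ᵇ m)
  L = 𝟙 l
  C = 𝟙 c
  M = 𝟙 (m ≡ᵇ e)
  A = 𝟙 (α + β ≡ᵇ b)
  E = 𝟙 (0 <ᵇ e)
  Q = 𝟙 (β ≤ᵇ b)
  B = 𝟙 (α ≡ᵇ b ∸ β)
  regroup : ∀ t p l c m a → (t * (p * (l * c))) * (m * a) ≡ t * l * c * (p * m) * a
  regroup = solve-∀
  regroup′ : ∀ t l c e m q x → t * l * c * (e * m) * (q * x) ≡ t * (q * (e * (l * (m * (x * c)))))
  regroup′ = solve-∀

splitWeight-shift : ∀ a b v s → maxL v ≤ a →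
  𝟙 (splitWeight a b (shift (maxL v) s) v)
  ≡ 𝟙 (isLSTail v) * (𝟙 (ascˡ v ≤ᵇ b) * (𝟙 (0 <ᵇ a ∸ maxL v)
      * 𝟙 (not (null s) ∧ isSLˡ s ∧ counted (a ∸ maxL v) (b ∸ ascˡ v) s)))
splitWeight-shift a b v [] _ rewrite ∧-zeroʳ (isLSTail v) =
  sym (zero-product (𝟙 (isLSTail v)) (𝟙 (ascˡ v ≤ᵇ b)) (𝟙 (0 <ᵇ a ∸ maxL v)))
  where
  zero-product : ∀ t q e → t * (q * (e * 0)) ≡ 0
  zero-product = solve-∀
splitWeight-shift a b v s@(x ∷ s′) maxv≤a = trans
  (cong 𝟙 (cong₂ _∧_ (cong (isLSTail v ∧_) (isLSHead-shift c s)) (cong₂ _∧_ maxEq ascEq)))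
  (𝟙-head-tail (isLSTail v) (isSLˡ s) (not (contains021ˡ s)) (maxL s) (a ∸ c) (ascˡ s) (ascˡ v) b)
  where
  c = maxL v
  maxEq : (maxL (shift c s) ≡ᵇ a) ≡ (maxL s ≡ᵇ a ∸ c)
  maxEq = trans (cong₂ _≡ᵇ_ (maxL-shift c x s′) (sym (m+[n∸m]≡n maxv≤a))) (≡ᵇ-shift c (maxL s) (a ∸ c))
  ascEq : (ascˡ (shift c s) + ascˡ v ≡ᵇ b) ≡ (ascˡ s + ascˡ v ≡ᵇ b)
  ascEq = cong (λ k → k + ascˡ v ≡ᵇ b) (ascˡ-shift c s)

splitWeight-¬above : ∀ a b s v → ¬ All (maxL v ≤_) s → splitWeight a b s v ≡ false
splitWeight-¬above a b s v ¬above
  rewrite dec-false (all? (maxL v ≤?_) s) ¬above | ∧-zeroʳ (isLSTail v) = refl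

coefS-as-∑ : ∀ k e b → coefS k e b ≡ ∑[ s ∈ listsUpTo k e ] 𝟙 (not (null s) ∧ isSLˡ s ∧ counted e b s)
coefS-as-∑ = coeff-as-∑ isSL isSLˡ isSL-toList

∑-splitWeight-heads : ∀ k a b v → maxL v ≤ a →
  ∑[ s ∈ listsUpTo k a ] 𝟙 (splitWeight a b s v)
  ≡ 𝟙 (isLSTail v) * (𝟙 (ascˡ v ≤ᵇ b) * coefS⁺ k (a ∸ maxL v) (b ∸ ascˡ v))
∑-splitWeight-heads k a b v maxv≤a = begin
  ∑[ s ∈ listsUpTo k a ] 𝟙 (splitWeight a b s v)
    ≡⟨ cong (λ a′ → ∑[ s ∈ listsUpTo k a′ ] 𝟙 (splitWeight a b s v)) a≡c+e ⟩
  ∑[ s ∈ listsUpTo k (c + e) ] 𝟙 (splitWeight a b s v)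
    ≡⟨ ∑-listsUpTo-shift k c e _ (λ s ¬above → cong 𝟙 (splitWeight-¬above a b s v ¬above)) ⟩
  ∑[ s ∈ listsUpTo k e ] 𝟙 (splitWeight a b (shift c s) v)
    ≡⟨ ∑-cong (listsUpTo k e) (λ s → splitWeight-shift a b v s maxv≤a) ⟩
  ∑[ s ∈ listsUpTo k e ] (T * (Q * (E * Sw s)))
    ≡⟨ ∑-cong (listsUpTo k e) (λ s → sym (*-assoc T Q (E * Sw s))) ⟩
  ∑[ s ∈ listsUpTo k e ] (T * Q * (E * Sw s))
    ≡⟨ ∑-*ˡ (T * Q) (listsUpTo k e) (λ s → E * Sw s) ⟨
  T * Q * ∑[ s ∈ listsUpTo k e ] (E * Sw s)
    ≡⟨ cong (T * Q *_) (∑-*ˡ E (listsUpTo k e) Sw) ⟨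
  T * Q * (E * ∑ (listsUpTo k e) Sw)
    ≡⟨ cong (λ z → T * Q * (E * z)) (coefS-as-∑ k e (b ∸ ascˡ v)) ⟨
  T * Q * coefS⁺ k e (b ∸ ascˡ v)
    ≡⟨ *-assoc T Q _ ⟩
  T * (Q * coefS⁺ k e (b ∸ ascˡ v)) ∎
  where
  open ≡-Reasoning
  c = maxL v
  e = a ∸ c
  a≡c+e = sym (m+[n∸m]≡n maxv≤a)
  T = 𝟙 (isLSTail v)
  Q = 𝟙 (ascˡ v ≤ᵇ b)
  E = 𝟙 (0 <ᵇ e)
  Sw : List ℕ → ℕ
  Sw s = 𝟙 (not (null s) ∧ isSLˡ s ∧ counted e (b ∸ ascˡ v) s)

𝟙-counted : ∀ a b v →
            𝟙 (not (null v) ∧ counted a b v) ≡ 𝟙 (maxL v ≡ᵇ a) * (𝟙 (ascˡ v ≡ᵇ b) * 𝟙 (isLSTail v))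
𝟙-counted a b v = begin
  𝟙 (not (null v) ∧ counted a b v)
    ≡⟨ cong 𝟙 (∧-rotate (not (null v)) (maxL v ≡ᵇ a) (ascˡ v ≡ᵇ b) (not (contains021ˡ v))) ⟩
  𝟙 (isLSTail v ∧ (maxL v ≡ᵇ a) ∧ (ascˡ v ≡ᵇ b))
    ≡⟨ trans (𝟙-∧ (isLSTail v) _) (cong (𝟙 (isLSTail v) *_) (𝟙-∧ (maxL v ≡ᵇ a) (ascˡ v ≡ᵇ b))) ⟩
  𝟙 (isLSTail v) * (𝟙 (maxL v ≡ᵇ a) * 𝟙 (ascˡ v ≡ᵇ b))
    ≡⟨ *-comm (𝟙 (isLSTail v)) _ ⟩
  𝟙 (maxL v ≡ᵇ a) * 𝟙 (ascˡ v ≡ᵇ b) * 𝟙 (isLSTail v)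
    ≡⟨ *-assoc (𝟙 (maxL v ≡ᵇ a)) _ _ ⟩
  𝟙 (maxL v ≡ᵇ a) * (𝟙 (ascˡ v ≡ᵇ b) * 𝟙 (isLSTail v)) ∎
  where open ≡-Reasoning

∑-counted-collapse : ∀ k a b v → maxL v ≤ a →
  ∑[ a₁ < suc a ] ∑[ b₁ < suc b ] (𝟙 (not (null v) ∧ counted a₁ b₁ v) * coefS⁺ k (a ∸ a₁) (b ∸ b₁))
  ≡ 𝟙 (isLSTail v) * (𝟙 (ascˡ v ≤ᵇ b) * coefS⁺ k (a ∸ maxL v) (b ∸ ascˡ v))
∑-counted-collapse k a b v maxv≤a = begin
  ∑[ a₁ < suc a ] ∑[ b₁ < suc b ] (𝟙 (not (null v) ∧ counted a₁ b₁ v) * X a₁ b₁)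
    ≡⟨ ∑<-cong (suc a) (λ a₁ _ → ∑<-cong (suc b) λ b₁ _ → factor a₁ b₁) ⟩
  ∑[ a₁ < suc a ] ∑[ b₁ < suc b ] (𝟙 (c ≡ᵇ a₁) * (𝟙 (β ≡ᵇ b₁) * (T * X a₁ b₁)))
    ≡⟨ ∑<-cong (suc a) (λ a₁ _ →
         ∑<-*ˡ (𝟙 (c ≡ᵇ a₁)) (suc b) (λ b₁ → 𝟙 (β ≡ᵇ b₁) * (T * X a₁ b₁))) ⟨
  ∑[ a₁ < suc a ] (𝟙 (c ≡ᵇ a₁) * ∑[ b₁ < suc b ] (𝟙 (β ≡ᵇ b₁) * (T * X a₁ b₁)))
    ≡⟨ ∑<-collapse (suc a) c (λ a₁ → ∑[ b₁ < suc b ] (𝟙 (β ≡ᵇ b₁) * (T * X a₁ b₁))) ⟩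
  𝟙 (c <ᵇ suc a) * ∑[ b₁ < suc b ] (𝟙 (β ≡ᵇ b₁) * (T * X c b₁))
    ≡⟨ cong₂ _*_ (cong 𝟙 (dec-true (c <? suc a) (s≤s maxv≤a))) (∑<-collapse (suc b) β (λ b₁ → T * X c b₁)) ⟩
  1 * (𝟙 (β <ᵇ suc b) * (T * X c β))
    ≡⟨ cong (λ q → 1 * (𝟙 q * (T * X c β))) (<ᵇ-suc β b) ⟩
  1 * (𝟙 (β ≤ᵇ b) * (T * X c β))
    ≡⟨ regroup (𝟙 (β ≤ᵇ b)) T (X c β) ⟩
  T * (𝟙 (β ≤ᵇ b) * X c β) ∎
  where
  open ≡-Reasoning
  c = maxL v
  β = ascˡ v
  T = 𝟙 (isLSTail v)
  X : ℕ → ℕ → ℕ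
  X a₁ b₁ = coefS⁺ k (a ∸ a₁) (b ∸ b₁)
  regroup : ∀ q t x → 1 * (q * (t * x)) ≡ t * (q * x)
  regroup = solve-∀
  factor : ∀ a₁ b₁ → 𝟙 (not (null v) ∧ counted a₁ b₁ v) * X a₁ b₁
                     ≡ 𝟙 (c ≡ᵇ a₁) * (𝟙 (β ≡ᵇ b₁) * (T * X a₁ b₁))
  factor a₁ b₁ = trans (cong (_* X a₁ b₁) (𝟙-counted a₁ b₁ v))
    (trans (*-assoc (𝟙 (c ≡ᵇ a₁)) _ (X a₁ b₁))
           (cong (𝟙 (c ≡ᵇ a₁) *_) (*-assoc (𝟙 (β ≡ᵇ b₁)) T (X a₁ b₁))))

𝟙-LS-as-splits : ∀ n a b w → length w ≡ n →
  𝟙 (not (null w) ∧ isLSˡ w ∧ counted a b w)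
  ≡ ∑[ j < suc n ] 𝟙 (splitWeight a b (take (n ∸ j) w) (drop (n ∸ j) w))
𝟙-LS-as-splits n a b w ∣w∣≡n = begin
  𝟙 (not (null w) ∧ isLSˡ w ∧ counted a b w)
    ≡⟨ cong 𝟙 (LS-nonempty w) ⟩
  𝟙 (isLSˡ w ∧ counted a b w)
    ≡⟨ cong 𝟙 (∧-rotate (isLSˡ w) (maxL w ≡ᵇ a) (ascˡ w ≡ᵇ b) (not (contains021ˡ w))) ⟩
  𝟙 ((isLSˡ w ∧ not (contains021ˡ w)) ∧ stats)
    ≡⟨ trans (𝟙-∧ (isLSˡ w ∧ not (contains021ˡ w)) stats)
             (*-comm (𝟙 (isLSˡ w ∧ not (contains021ˡ w))) (𝟙 stats)) ⟩
  𝟙 stats * 𝟙 (isLSˡ w ∧ not (contains021ˡ w))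
    ≡⟨ cong (𝟙 stats *_) (∑-LSSplit-points n w ∣w∣≡n) ⟨
  𝟙 stats * ∑[ j < suc n ] 𝟙 (isLSSplit (take (n ∸ j) w) (drop (n ∸ j) w))
    ≡⟨ ∑<-*ˡ (𝟙 stats) (suc n) (λ j → 𝟙 (isLSSplit (take (n ∸ j) w) (drop (n ∸ j) w))) ⟩
  ∑[ j < suc n ] (𝟙 stats * 𝟙 (isLSSplit (take (n ∸ j) w) (drop (n ∸ j) w)))
    ≡⟨ ∑<-cong (suc n) (λ j _ → splitWeight-at j) ⟨
  ∑[ j < suc n ] 𝟙 (splitWeight a b (take (n ∸ j) w) (drop (n ∸ j) w)) ∎
  where
  open ≡-Reasoning
  stats = (maxL w ≡ᵇ a) ∧ (ascˡ w ≡ᵇ b)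
  LS-nonempty : ∀ w → not (null w) ∧ isLSˡ w ∧ counted a b w ≡ isLSˡ w ∧ counted a b w
  LS-nonempty [] = refl
  LS-nonempty (_ ∷ _) = refl
  splitWeight-at : ∀ j → 𝟙 (splitWeight a b (take (n ∸ j) w) (drop (n ∸ j) w))
                         ≡ 𝟙 stats * 𝟙 (isLSSplit (take (n ∸ j) w) (drop (n ∸ j) w))
  splitWeight-at j with isLSSplit (take (n ∸ j) w) (drop (n ∸ j) w) in split
  ... | false = sym (*-zeroʳ (𝟙 stats))
  ... | true = trans (cong 𝟙 (cong₂ _∧_ maxEq ascEq)) (sym (*-identityʳ (𝟙 stats)))
    where
    s = take (n ∸ j) w
    v = drop (n ∸ j) w
    lsSplit = isLSSplit⇒LSSplit s v split
    maxEq : (maxL s ≡ᵇ a) ≡ (maxL w ≡ᵇ a)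
    maxEq = cong (_≡ᵇ a) (trans (sym (LSSplit.maxL-s++v lsSplit)) (cong maxL (take++drop≡id (n ∸ j) w)))
    ascEq : (ascˡ s + ascˡ v ≡ᵇ b) ≡ (ascˡ w ≡ᵇ b)
    ascEq = cong (_≡ᵇ b) (trans (sym (ascˡ-++ s v (LSSplit.s≽v lsSplit))) (cong ascˡ (take++drop≡id (n ∸ j) w)))

coefN-as-∑ : ∀ j a₁ a b₁ → a₁ ≤ a →
             coefN j a₁ b₁ ≡ ∑[ v ∈ listsUpTo j a ] 𝟙 (not (null v) ∧ counted a₁ b₁ v)
coefN-as-∑ j a₁ a b₁ a₁≤a = begin
  coefN j a₁ b₁
    ≡⟨ coeff-as-∑ (λ _ → true) (λ _ → true) (λ _ → refl) j a₁ b₁ ⟩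
  ∑[ v ∈ listsUpTo j a₁ ] 𝟙 (not (null v) ∧ counted a₁ b₁ v)
    ≡⟨ ∑-listsUpTo-raise j a₁ (a ∸ a₁) _ (λ v a₁<maxv → cong 𝟙 (larger v a₁<maxv)) ⟨
  ∑[ v ∈ listsUpTo j (a₁ + (a ∸ a₁)) ] 𝟙 (not (null v) ∧ counted a₁ b₁ v)
    ≡⟨ cong (λ a′ → ∑[ v ∈ listsUpTo j a′ ] 𝟙 (not (null v) ∧ counted a₁ b₁ v)) (m+[n∸m]≡n a₁≤a) ⟩
  ∑[ v ∈ listsUpTo j a ] 𝟙 (not (null v) ∧ counted a₁ b₁ v) ∎
  where
  open ≡-Reasoning
  larger : ∀ v → a₁ < maxL v → not (null v) ∧ counted a₁ b₁ v ≡ false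
  larger v a₁<maxv rewrite dec-false (maxL v ≟ a₁) (>⇒≢ a₁<maxv) = ∧-zeroʳ (not (null v))

∑-splitWeight-at : ∀ k j a b →
  ∑[ w ∈ listsUpTo (k + j) a ] 𝟙 (splitWeight a b (take k w) (drop k w))
  ≡ ∑[ a₁ < suc a ] ∑[ b₁ < suc b ] (coefN j a₁ b₁ * coefS⁺ k (a ∸ a₁) (b ∸ b₁))
∑-splitWeight-at k j a b = begin
  ∑[ w ∈ listsUpTo (k + j) a ] 𝟙 (splitWeight a b (take k w) (drop k w))
    ≡⟨ ∑-listsUpTo-++ k j a (λ w → 𝟙 (splitWeight a b (take k w) (drop k w))) ⟩
  ∑[ s ∈ listsUpTo k a ] ∑[ v ∈ listsUpTo j a ] 𝟙 (splitWeight a b (take k (s ++ v)) (drop k (s ++ v)))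
    ≡⟨ listsUpTo-cong k a (λ s ∣s∣≡k _ → ∑-cong (listsUpTo j a) λ v →
         cong 𝟙 (cong₂ (splitWeight a b) (take-++-length s v ∣s∣≡k) (drop-++-length s v ∣s∣≡k))) ⟩
  ∑[ s ∈ listsUpTo k a ] ∑[ v ∈ listsUpTo j a ] 𝟙 (splitWeight a b s v)
    ≡⟨ ∑-comm (listsUpTo k a) (listsUpTo j a) (λ s v → 𝟙 (splitWeight a b s v)) ⟩
  ∑[ v ∈ listsUpTo j a ] ∑[ s ∈ listsUpTo k a ] 𝟙 (splitWeight a b s v)
    ≡⟨ listsUpTo-cong j a (λ v _ maxv≤a →
         trans (∑-splitWeight-heads k a b v maxv≤a) (sym (∑-counted-collapse k a b v maxv≤a))) ⟩
  ∑[ v ∈ listsUpTo j a ] ∑[ a₁ < suc a ] ∑[ b₁ < suc b ] (W a₁ b₁ v * X a₁ b₁)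
    ≡⟨ ∑<-∑-comm (suc a) (listsUpTo j a) (λ a₁ v → ∑[ b₁ < suc b ] (W a₁ b₁ v * X a₁ b₁)) ⟨
  ∑[ a₁ < suc a ] ∑[ v ∈ listsUpTo j a ] ∑[ b₁ < suc b ] (W a₁ b₁ v * X a₁ b₁)
    ≡⟨ ∑<-cong (suc a) (λ a₁ a₁<1+a →
         trans (sym (∑<-∑-comm (suc b) (listsUpTo j a) (λ b₁ v → W a₁ b₁ v * X a₁ b₁)))
               (∑<-cong (suc b) λ b₁ _ → trans (sym (∑-*ʳ (X a₁ b₁) (listsUpTo j a) (W a₁ b₁)))
                                              (cong (_* X a₁ b₁) (sym (coefN-as-∑ j a₁ a b₁ (s≤s⁻¹ a₁<1+a)))))) ⟩
  ∑[ a₁ < suc a ] ∑[ b₁ < suc b ] (coefN j a₁ b₁ * X a₁ b₁) ∎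
  where
  open ≡-Reasoning
  W : ℕ → ℕ → List ℕ → ℕ
  W a₁ b₁ v = 𝟙 (not (null v) ∧ counted a₁ b₁ v)
  X : ℕ → ℕ → ℕ
  X a₁ b₁ = coefS⁺ k (a ∸ a₁) (b ∸ b₁)

coefL-convolution : ∀ n a b → coefL n a b ≡
  ∑[ j < suc n ] ∑[ a₁ < suc a ] ∑[ b₁ < suc b ] (coefN j a₁ b₁ * coefS⁺ (n ∸ j) (a ∸ a₁) (b ∸ b₁))
coefL-convolution n a b = begin
  coefL n a b
    ≡⟨ coeff-as-∑ isLS isLSˡ isLS-toList n a b ⟩
  ∑[ w ∈ listsUpTo n a ] 𝟙 (not (null w) ∧ isLSˡ w ∧ counted a b w)
    ≡⟨ listsUpTo-cong n a (λ w ∣w∣≡n _ → 𝟙-LS-as-splits n a b w ∣w∣≡n) ⟩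
  ∑[ w ∈ listsUpTo n a ] ∑[ j < suc n ] 𝟙 (splitWeight a b (take (n ∸ j) w) (drop (n ∸ j) w))
    ≡⟨ ∑<-∑-comm (suc n) (listsUpTo n a) (λ j w → 𝟙 (splitWeight a b (take (n ∸ j) w) (drop (n ∸ j) w))) ⟨
  ∑[ j < suc n ] ∑[ w ∈ listsUpTo n a ] 𝟙 (splitWeight a b (take (n ∸ j) w) (drop (n ∸ j) w))
    ≡⟨ ∑<-cong (suc n) (λ j j<1+n → subst
         (λ m → ∑[ w ∈ listsUpTo m a ] 𝟙 (splitWeight a b (take (n ∸ j) w) (drop (n ∸ j) w))
              ≡ ∑[ a₁ < suc a ] ∑[ b₁ < suc b ] (coefN j a₁ b₁ * coefS⁺ (n ∸ j) (a ∸ a₁) (b ∸ b₁)))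
         (m∸n+n≡m (s≤s⁻¹ j<1+n)) (∑-splitWeight-at (n ∸ j) j a b)) ⟩
  ∑[ j < suc n ] ∑[ a₁ < suc a ] ∑[ b₁ < suc b ] (coefN j a₁ b₁ * coefS⁺ (n ∸ j) (a ∸ a₁) (b ∸ b₁)) ∎
  where open ≡-Reasoning

-- Series

zeros : ℕ → List ℕ
zeros n = replicate n 0

listsUpTo-zero : ∀ n → listsUpTo n 0 ≡ [ zeros n ]
listsUpTo-zero zero = refl
listsUpTo-zero (suc n) rewrite listsUpTo-zero n = refl

maxL-zeros : ∀ n → maxL (zeros n) ≡ 0
maxL-zeros zero = refl
maxL-zeros (suc n) = maxL-zeros n

ascˡ-zeros : ∀ n → ascˡ (zeros n) ≡ 0
ascˡ-zeros zero = refl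
ascˡ-zeros (suc zero) = refl
ascˡ-zeros (suc (suc n)) = ascˡ-zeros (suc n)

contains021-zeros : ∀ n → contains021ˡ (zeros n) ≡ false
contains021-zeros zero = refl
contains021-zeros (suc n) rewrite contains21Above-≤ 0 (zeros n) (λ y∈ → subst (_ ≤_) (maxL-zeros n) (∈⇒≤maxL y∈))
  = contains021-zeros n

isSL-zeros : ∀ n → isSLˡ (zeros (suc n)) ≡ true
isSL-zeros n rewrite n≤0⇒n≡0 (minL-≤ (zeros (suc n)) (here refl)) | maxL-zeros n =
  dec-true (lastIndexOfˡ 0 (zeros (suc n)) <? suc (lastIndexOfˡ 0 (zeros (suc n)))) ≤-refl

coefS-lar0 : ∀ k b → coefS k 0 b ≡ coefGeom k 0 b
coefS-lar0 zero b = refl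
coefS-lar0 (suc m) b
  rewrite coefS-as-∑ (suc m) 0 b | listsUpTo-zero (suc m)
        | isSL-zeros m | maxL-zeros m | ascˡ-zeros (suc m) | contains021-zeros (suc m) with b
... | zero = refl
... | suc _ = refl

coefGeom-lar>0 : ∀ k e b → coefGeom k (suc e) b ≡ 0
coefGeom-lar>0 zero e b = refl
coefGeom-lar>0 (suc k) e b = refl

𝓢⊝geom≡coefS⁺ : ∀ k e b → (𝓢 ⊝ geom) k e b ≡ ℤ.+ coefS⁺ k e b
𝓢⊝geom≡coefS⁺ k zero b rewrite coefS-lar0 k b = ℤ.+-inverseʳ (ℤ.+ coefGeom k 0 b)
𝓢⊝geom≡coefS⁺ k (suc e) b rewrite coefGeom-lar>0 k e b = trans (ℤ.+-identityʳ _) (cong ℤ.+_ (sym (+-identityʳ _)))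

sumℤ-+ : ∀ xs (f : ℕ → ℕ) → sumℤ (map (λ i → ℤ.+ f i) xs) ≡ ℤ.+ ∑ xs f
sumℤ-+ [] f = refl
sumℤ-+ (x ∷ xs) f = trans (cong (ℤ._+_ (ℤ.+ f x)) (sumℤ-+ xs f)) (sym (ℤ.pos-+ (f x) (∑ xs f)))

conv1-cong : ∀ k {f g : ℕ → ℕ → ℤ} → (∀ i j → f i j ≡ g i j) → conv1 k f ≡ conv1 k g
conv1-cong k eq = cong sumℤ (map-cong (λ i → eq i (k ∸ i)) (upTo (suc k)))

conv1-+ : ∀ k (f : ℕ → ℕ → ℕ) → conv1 k (λ i j → ℤ.+ f i j) ≡ ℤ.+ ∑[ i < suc k ] f i (k ∸ i)
conv1-+ k f = trans (sumℤ-+ (upTo (suc k)) (λ i → f i (k ∸ i))) (cong ℤ.+_ (∑-applyUpTo (suc k) id _))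

⊛-congʳ : ∀ F {G H : Series} → (∀ n a b → G n a b ≡ H n a b) → ∀ n a b → (F ⊛ G) n a b ≡ (F ⊛ H) n a b
⊛-congʳ F G≡H n a b = conv1-cong n λ n₁ n₂ → conv1-cong a λ a₁ a₂ → conv1-cong b λ b₁ b₂ →
  cong (F n₁ a₁ b₁ ℤ.*_) (G≡H n₂ a₂ b₂)

⊛-ofℕ : ∀ f g n a b → (ofℕ f ⊛ ofℕ g) n a b
        ≡ ℤ.+ ∑[ n₁ < suc n ] ∑[ a₁ < suc a ] ∑[ b₁ < suc b ]
                (f n₁ a₁ b₁ * g (n ∸ n₁) (a ∸ a₁) (b ∸ b₁))
⊛-ofℕ f g n a b =
  trans (conv1-cong n λ n₁ n₂ →
    trans (conv1-cong a λ a₁ a₂ →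
      trans (conv1-cong b λ b₁ b₂ → sym (ℤ.pos-* (f n₁ a₁ b₁) (g n₂ a₂ b₂)))
            (conv1-+ b λ b₁ b₂ → f n₁ a₁ b₁ * g n₂ a₂ b₂))
          (conv1-+ a λ a₁ a₂ → ∑[ b₁ < suc b ] (f n₁ a₁ b₁ * g n₂ a₂ (b ∸ b₁))))
        (conv1-+ n λ n₁ n₂ → ∑[ a₁ < suc a ] ∑[ b₁ < suc b ] (f n₁ a₁ b₁ * g n₂ (a ∸ a₁) (b ∸ b₁)))

mainTheorem9 : ∀ n a b → 𝓛 n a b ≡ (𝓝 ⊛ (𝓢 ⊝ geom)) n a b
mainTheorem9 n a b = begin
  𝓛 n a b
    ≡⟨ cong ℤ.+_ (coefL-convolution n a b) ⟩
  ℤ.+ ∑[ j < suc n ] ∑[ a₁ < suc a ] ∑[ b₁ < suc b ] (coefN j a₁ b₁ * coefS⁺ (n ∸ j) (a ∸ a₁) (b ∸ b₁))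
    ≡⟨ ⊛-ofℕ coefN coefS⁺ n a b ⟨
  (𝓝 ⊛ ofℕ coefS⁺) n a b
    ≡⟨ ⊛-congʳ 𝓝 𝓢⊝geom≡coefS⁺ n a b ⟨
  (𝓝 ⊛ (𝓢 ⊝ geom)) n a b ∎
  where open ≡-Reasoning
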